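{- For every $n\ge0$, $L_n(\boldsymbol{e}(1,1),y)$ equals the Lah polynomial $L_n(y)$, the generating polynomial of partitions of $[n]$ into nonempty lists with a weight $y$ for each list. More generally, for indeterminates $x_1,x_2$, $L_n(\boldsymbol{e}(x_1,x_2),y)$ is the generating polynomial of partitions of $[n]$ into nonempty lists, with a weight $y$ for each list, a weight $x_1$ for each descent in a list, and a weight $x_2$ for each ascent in a list.
   Context: $\boldsymbol{e}(x_1,x_2)=(1,x_1+x_2,x_1x_2,0,0,\dots)$ is the sequence of elementary symmetric polynomials in $x_1,x_2$. A partition of $[n]$ into nonempty lists is a set partition of $[n]$ together with a linear ordering $w_1w_2\cdots w_m$ of each block; a descent (resp. ascent) in a list is an index $p$ with $w_p>w_{p+1}$ (resp. $w_p<w_{p+1}$). Generic Lah polynomials: an ordered tree is a rooted tree with linearly ordered children at each vertex; an increasing ordered tree on a set of integers is one bijectively labeled by that set with children having larger labels than parents. For $\boldsymbol{\phi}=(\phi_i)_{i\ge0}$, $L_{n,k}(\boldsymbol{\phi})$ is the sum over unordered forests of $k$ increasing ordered trees whose vertex sets partition $[n]$ of $\prod_v\phi_{\deg(v)}$ ($\deg(v)$ = number of children; $L_{0,0}=1$), and $L_n(\boldsymbol{\phi},y)=\sum_{k=0}^nL_{n,k}(\boldsymbol{\phi})y^k$. -}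

module Defs where

open import Level using (Level)
open import Algebra.Bundles using (CommutativeSemiring)
open import Data.Nat as ℕ using (ℕ; zero; suc)
open import Data.Fin as Fin using (Fin; toℕ; _≟_)
open import Data.Fin.Properties as FinP using ()
open import Data.List as List using (List; []; _∷_; [_]; concat; concatMap; length; filter; map; foldr; allFin; upTo)
open import Data.List.Relation.Unary.All as All using (All)
open import Data.List.Relation.Unary.Linked as Linked using (Linked)
open import Data.List.Membership.Propositional using (_∈_; _∉_)
import Data.Nat.ListAction as ListAction
open import Data.Vec as Vec using (Vec; lookup; toList)
open import Data.Product using (_×_; _,_)
open import Data.Empty using (⊥)
open import Data.Unit using (⊤; tt)
open import Relation.Nullary using (Dec; yes; no; ¬?)
open import Relation.Nullary.Decidable using (_×-dec_)
open import Relation.Binary.PropositionalEquality using (_≡_)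
import Data.List.Relation.Unary.Unique.DecPropositional as UniqueDec
import Data.List.Membership.DecPropositional as MemDec
open import Data.List.Relation.Unary.Unique.Propositional using (Unique)

allLists : ∀ {a} {A : Set a} → List A → ℕ → List (List A)
allLists xs zero    = [ [] ]
allLists xs (suc m) = [] ∷ concatMap (λ x → map (x ∷_) (allLists xs m)) xs

allVecs : ∀ {a} {A : Set a} → List A → (n : ℕ) → List (Vec A n)
allVecs xs zero    = [ Vec.[] ]
allVecs xs (suc n) = concatMap (λ x → map (x Vec.∷_) (allVecs xs n)) xs

-- Increasing ordered forests on the vertex set Fin n  (labels 0..n-1
-- stand for 1..n; only the order of labels matters).
--
-- An (unordered) forest of ordered trees on Fin n is given by assigning to
-- each vertex v the linearly ordered list  ch v  of its children.
-- It is a forest of increasing ordered trees iff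
--   * every child has a larger label than its parent, and
--   * no vertex is listed as a child twice (each vertex has ≤ 1 parent).
-- (Acyclicity follows from increasingness.)  Roots = vertices that are
-- nobody's child; the number of trees is the number of roots.

Children : ℕ → Set
Children n = Vec (List (Fin n)) n

allChildEdges : ∀ {n} → Children n → List (Fin n)
allChildEdges ch = concat (toList ch)

IsIncOrdForest : ∀ {n} → Children n → Set
IsIncOrdForest {n} ch =
  (∀ (v : Fin n) → All (λ w → toℕ v ℕ.< toℕ w) (lookup ch v))
  × Unique (allChildEdges ch)

isIncOrdForest? : ∀ {n} (ch : Children n) → Dec (IsIncOrdForest ch)
isIncOrdForest? {n} ch =
  FinP.all? (λ v → All.all? (λ w → toℕ v ℕ.<? toℕ w) (lookup ch v))
  ×-dec UniqueDec.unique? _≟_ (allChildEdges ch)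

roots : ∀ {n} → Children n → List (Fin n)
roots {n} ch = filter (λ v → ¬? (MemDec._∈?_ _≟_ v (allChildEdges ch))) (allFin n)

numTrees : ∀ {n} → Children n → ℕ
numTrees ch = length (roots ch)

deg : ∀ {n} → Children n → Fin n → ℕ
deg ch v = length (lookup ch v)

-- every forest occurs in this list (a child list has distinct entries,
-- hence length ≤ n); we then keep exactly the increasing ordered forests
incOrdForests : (n : ℕ) → List (Children n)
incOrdForests n = filter isIncOrdForest? (allVecs (allLists (allFin n) n) n)

-- Represented as the list of its blocks (each block a list), with the
-- blocks sorted by strictly increasing first element; this is a canonical
-- representative of the (unordered) set of blocks.

_<head_ : ∀ {n} → List (Fin n) → List (Fin n) → Set
(x ∷ _) <head (y ∷ _) = toℕ x ℕ.< toℕ y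
_       <head _       = ⊥

_<head?_ : ∀ {n} (b c : List (Fin n)) → Dec (b <head c)
(x ∷ _) <head? (y ∷ _) = toℕ x ℕ.<? toℕ y
[]      <head? _       = no (λ ())
(_ ∷ _) <head? []      = no (λ ())

NonEmpty : ∀ {n} → List (Fin n) → Set
NonEmpty []      = ⊥
NonEmpty (_ ∷ _) = ⊤

nonEmpty? : ∀ {n} (b : List (Fin n)) → Dec (NonEmpty b)
nonEmpty? []      = no (λ ())
nonEmpty? (_ ∷ _) = yes tt

IsListPartition : ∀ {n} → List (List (Fin n)) → Set
IsListPartition {n} bs =
  All NonEmpty bs
  × Unique (concat bs)
  × (∀ (i : Fin n) → i ∈ concat bs)
  × Linked _<head_ bs

isListPartition? : ∀ {n} (bs : List (List (Fin n))) → Dec (IsListPartition bs)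
isListPartition? {n} bs =
  All.all? nonEmpty? bs
  ×-dec UniqueDec.unique? _≟_ (concat bs)
  ×-dec FinP.all? (λ i → MemDec._∈?_ _≟_ i (concat bs))
  ×-dec Linked.linked? _<head?_ bs

-- every partition into lists occurs among lists of ≤ n blocks of length ≤ n
listPartitions : (n : ℕ) → List (List (List (Fin n)))
listPartitions n = filter isListPartition? (allLists (allLists (allFin n) n) n)

lt01 : ∀ {n} → Fin n → Fin n → ℕ
lt01 a b with toℕ a ℕ.<? toℕ b
... | yes _ = 1
... | no  _ = 0

descents : ∀ {n} → List (Fin n) → ℕ
descents (a ∷ b ∷ w) = lt01 b a ℕ.+ descents (b ∷ w)
descents _ = 0

ascents : ∀ {n} → List (Fin n) → ℕ
ascents (a ∷ b ∷ w) = lt01 a b ℕ.+ ascents (b ∷ w)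
ascents _ = 0

-- Polynomials are evaluated in an arbitrary commutative semiring
-- (ℕ[x₁,x₂,y] is the free commutative semiring, so this is equivalent
-- to the identity of polynomials with indeterminates x₁, x₂, y).

module _ {c ℓ : Level} (R : CommutativeSemiring c ℓ) where
  open CommutativeSemiring R

  pow : Carrier → ℕ → Carrier
  pow x zero    = 1#
  pow x (suc k) = x * pow x k

  sumR : List Carrier → Carrier
  sumR = foldr _+_ 0#

  prodR : List Carrier → Carrier
  prodR = foldr _*_ 1#

  eSeq : Carrier → Carrier → ℕ → Carrier
  eSeq x₁ x₂ 0 = 1#
  eSeq x₁ x₂ 1 = x₁ + x₂
  eSeq x₁ x₂ 2 = x₁ * x₂
  eSeq x₁ x₂ (suc (suc (suc _))) = 0#

  forestWeight : (ℕ → Carrier) → ∀ {n} → Children n → Carrier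
  forestWeight φ {n} ch = prodR (map (λ v → φ (deg ch v)) (allFin n))

  LahGen : (ℕ → Carrier) → (n k : ℕ) → Carrier
  LahGen φ n k =
    sumR (map (forestWeight φ)
              (filter (λ ch → numTrees ch ℕ.≟ k) (incOrdForests n)))

  LahPolyGen : (ℕ → Carrier) → Carrier → ℕ → Carrier
  LahPolyGen φ y n = sumR (map (λ k → LahGen φ n k * pow y k) (upTo (suc n)))

  LahPoly : Carrier → ℕ → Carrier
  LahPoly y n = sumR (map (λ bs → pow y (length bs)) (listPartitions n))

  LahPolyDesAsc : Carrier → Carrier → Carrier → ℕ → Carrier
  LahPolyDesAsc x₁ x₂ y n =
    sumR (map (λ bs → pow y (length bs)
                      * (pow x₁ (ListAction.sum (map descents bs))
                      * pow x₂ (ListAction.sum (map ascents bs))))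
              (listPartitions n))

module Submission where

-- Both sides are values at h = y^(-) of sums
--   T n h = Σ_{objects on [n]} weight · h(number of components),
-- over increasing ordered forests (components: trees) and over list
-- partitions (components: lists).  Removing the minimal label 0 shows that
-- both satisfy  T 0 h = h 0  and  T (n+1) h = T n (D h), where
--   (D h)(t) = h(t+1) + t (x₁+x₂) h(t) + t(t-1) x₁x₂ h(t-1),
-- hence both equal (Dⁿ h)(0).  For forests, 0 is a root whose ordered
-- children are an arrangement of j of the t old roots (weight e_j, leaving
-- t+1-j trees).  For list partitions, 0 forms a new list, starts a list
-- (one more ascent), ends a list (one more descent), or joins two lists x, y
-- into x0y (one more of each, one list fewer).

open import Defs
open import Level using (Level)
open import Algebra.Bundles using (CommutativeSemiring)
open import Data.Nat using (ℕ)
open import Data.Product using (_×_)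

module ListFacts where

  open import Function using (_∘_; mk⇔)
  open import Data.List using (List; []; _∷_; _++_; concat; concatMap; map)
  open import Data.List.Relation.Unary.All as All using (All; []; _∷_)
  import Data.List.Relation.Unary.All.Properties as AllP
  open import Data.List.Relation.Unary.Any using (here; there)
  open import Data.List.Relation.Unary.AllPairs using ([]; _∷_)
  open import Data.List.Membership.Propositional using (_∈_; _∉_; find; lose)
  open import Data.List.Membership.Propositional.Properties
    using (∈-map⁺; ∈-concatMap⁺; ∈-concatMap⁻)
  open import Data.List.Membership.Propositional.Properties.WithK using (unique∧set⇒bag)
  open import Data.List.Relation.Binary.BagAndSetEquality using (∼bag⇒↭)
  open import Data.List.Relation.Unary.Unique.Propositional using (Unique)
  import Data.List.Relation.Unary.Unique.Propositional.Properties as UniqueP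
  open import Data.List.Relation.Binary.Permutation.Propositional as Perm using (_↭_)
  import Data.List.Relation.Binary.Permutation.Propositional.Properties as PermP
  import Data.List.Relation.Binary.Permutation.Setoid.Properties as PermSetoidP
  open import Data.Product using (∃; _,_)
  open import Relation.Nullary using (¬_)
  open import Relation.Binary.PropositionalEquality
    using (_≡_; refl; sym; trans; setoid)

  private variable
    a b k : Level
    A : Set a
    B : Set b
    K : Set k

  Unique-resp-↭ : {xs ys : List A} → xs ↭ ys → Unique xs → Unique ys
  Unique-resp-↭ {A = A} p = PermSetoidP.Unique-resp-↭ (setoid A) (Perm.↭⇒↭ₛ p)

  unique-↭ : {xs ys : List A} → Unique xs → Unique ys →
             (∀ {z} → z ∈ xs → z ∈ ys) → (∀ {z} → z ∈ ys → z ∈ xs) → xs ↭ ys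
  unique-↭ u v f g = ∼bag⇒↭ (unique∧set⇒bag u v (mk⇔ f g))

  concat-↭ : {xss yss : List (List A)} → xss ↭ yss → concat xss ↭ concat yss
  concat-↭ Perm.refl = Perm.↭-refl
  concat-↭ (Perm.prep xs p) = PermP.++⁺ˡ xs (concat-↭ p)
  concat-↭ (Perm.swap xs ys p) =
    Perm.↭-trans (PermP.++⁺ˡ xs (PermP.++⁺ˡ ys (concat-↭ p))) (PermP.shifts xs ys)
  concat-↭ (Perm.trans p q) = Perm.↭-trans (concat-↭ p) (concat-↭ q)

  ∈-concatMap-elim : (g : A → List B) (xs : List A) {z : B} →
                     z ∈ concatMap g xs → ∃ λ x → x ∈ xs × z ∈ g x
  ∈-concatMap-elim g xs m = find (∈-concatMap⁻ g m)

  ∈-concatMap-intro : (g : A → List B) {xs : List A} {x : A} {z : B} →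
                      x ∈ xs → z ∈ g x → z ∈ concatMap g xs
  ∈-concatMap-intro g x∈ z∈ = ∈-concatMap⁺ g (lose x∈ z∈)

  unique-concatMap : (g : A → List B) (κ : A → K) (key : B → K) (xs : List A) →
    Unique (map κ xs) → (∀ {x} → x ∈ xs → Unique (g x)) →
    (∀ {x z} → x ∈ xs → z ∈ g x → key z ≡ κ x) → Unique (concatMap g xs)
  unique-concatMap g κ key [] _ _ _ = []
  unique-concatMap g κ key (x ∷ xs) (x∉ ∷ u) ug keyOf =
    UniqueP.++⁺ (ug (here refl))
      (unique-concatMap g κ key xs u (ug ∘ there) (keyOf ∘ there)) disjoint
    where
    disjoint : ∀ {z} → ¬ (z ∈ g x × z ∈ concatMap g xs)
    disjoint (m₁ , m₂) with ∈-concatMap-elim g xs m₂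
    ... | y , y∈ , m = All.lookup x∉ (∈-map⁺ κ y∈)
                         (trans (sym (keyOf (here refl) m₁)) (keyOf (there y∈) m))

  unique-++ˡ : (xs : List A) {ys : List A} → Unique (xs ++ ys) → Unique xs
  unique-++ˡ [] u = []
  unique-++ˡ (x ∷ xs) (x∉ ∷ u) = AllP.++⁻ˡ xs x∉ ∷ unique-++ˡ xs u

  unique-++ʳ : (xs : List A) {ys : List A} → Unique (xs ++ ys) → Unique ys
  unique-++ʳ [] u = u
  unique-++ʳ (x ∷ xs) (_ ∷ u) = unique-++ʳ xs u

  unique-++-disjoint : (xs : List A) {ys : List A} {z : A} →
                       Unique (xs ++ ys) → z ∈ xs → z ∉ ys
  unique-++-disjoint (x ∷ xs) (x∉ ∷ u) (here refl) z∈ = All.lookup (AllP.++⁻ʳ xs x∉) z∈ refl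
  unique-++-disjoint (x ∷ xs) (_ ∷ u) (there z∈) = unique-++-disjoint xs u z∈

  unique-concat : (xss : List (List A)) {xs : List A} →
                  Unique (concat xss) → xs ∈ xss → Unique xs
  unique-concat (ys ∷ xss) u (here refl) = unique-++ˡ ys u
  unique-concat (ys ∷ xss) u (there m) = unique-concat xss (unique-++ʳ ys u) m

  decomposition-↭ : (g : A → List B) (key : B → A) {E : List A} {E' : List B} →
    Unique E → Unique E' → (∀ {x} → x ∈ E → Unique (g x)) →
    (∀ {x z} → x ∈ E → z ∈ g x → key z ≡ x) →
    (∀ {x z} → x ∈ E → z ∈ g x → z ∈ E') →
    (∀ {z} → z ∈ E' → ∃ λ x → x ∈ E × z ∈ g x) →
    E' ↭ concatMap g E
  decomposition-↭ g key {E} uE uE' ug keyOf sound complete =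
    unique-↭ uE' (unique-concatMap g (λ x → x) key E (UniqueP.map⁺ (λ e → e) uE) ug keyOf)
      (λ z∈ → let x , x∈ , m = complete z∈ in ∈-concatMap-intro g x∈ m)
      (λ z∈ → let x , x∈ , m = ∈-concatMap-elim g E z∈ in sound x∈ m)

module Enumerations where

  open import Function using (id)
  open import Data.Nat using (zero; suc; _+_; _≤_; z≤n; s≤s)
  open import Data.Nat.Properties using (+-suc)
  open import Data.Fin using (Fin; _≟_)
  open import Data.List using (List; []; _∷_; length; map; concatMap; filter; allFin; head)
  import Data.List.Properties as ListP
  open import Data.List.Relation.Unary.All as All using (All; []; _∷_)
  open import Data.List.Relation.Unary.Any using (here; there)
  open import Data.List.Relation.Unary.AllPairs using ([]; _∷_)
  open import Data.List.Membership.Propositional using (_∈_)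
  open import Data.List.Membership.Propositional.Properties
    using (∈-map⁺; ∈-map⁻; ∈-filter⁺; ∈-filter⁻; ∈-allFin)
  import Data.List.Membership.DecPropositional as MemDec
  open import Data.List.Relation.Unary.Unique.Propositional using (Unique)
  import Data.List.Relation.Unary.Unique.Propositional.Properties as UniqueP
  open import Data.List.Relation.Binary.Permutation.Propositional using (_↭_)
  import Data.List.Relation.Binary.Permutation.Propositional.Properties as PermP
  open import Data.Vec as Vec using (Vec; toList)
  import Data.Vec.Properties as VecP
  open import Data.Maybe using (just)
  open import Data.Maybe.Properties using (just-injective)
  open import Data.Product using (_,_; proj₂)
  open import Relation.Nullary using (yes; no; ¬?)
  open import Relation.Unary using (Decidable)
  open import Relation.Binary.PropositionalEquality using (_≡_; _≢_; refl; sym; trans; cong; subst)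
  open ListFacts

  private variable
    a : Level
    A : Set a

  allLists-unique : {xs : List A} (m : ℕ) → Unique xs → Unique (allLists xs m)
  allLists-unique zero u = [] ∷ []
  allLists-unique {A = A} {xs = xs} (suc m) u =
    All.tabulate nonempty ∷ unique-concatMap extend just head xs (UniqueP.map⁺ just-injective u)
                 (λ _ → UniqueP.map⁺ ListP.∷-injectiveʳ (allLists-unique m u)) headOf
    where
    extend : A → List (List A)
    extend x = map (x ∷_) (allLists xs m)
    headOf : ∀ {x z} → x ∈ xs → z ∈ extend x → head z ≡ just x
    headOf _ z∈ with ∈-map⁻ _ z∈
    ... | _ , _ , refl = refl
    nonempty : ∀ {z} → z ∈ concatMap extend xs → [] ≢ z
    nonempty z∈ refl with ∈-concatMap-elim extend xs z∈
    ... | x , x∈ , m with headOf x∈ m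
    ... | ()

  allLists-complete : {xs : List A} (m : ℕ) {l : List A} →
                      All (_∈ xs) l → length l ≤ m → l ∈ allLists xs m
  allLists-complete zero [] z≤n = here refl
  allLists-complete (suc m) [] _ = here refl
  allLists-complete {xs = xs} (suc m) (x∈ ∷ l∈) (s≤s le) =
    there (∈-concatMap-intro (λ x → map (x ∷_) (allLists xs m)) x∈
            (∈-map⁺ _ (allLists-complete m l∈ le)))

  allVecs-unique : {xs : List A} (n : ℕ) → Unique xs → Unique (allVecs xs n)
  allVecs-unique zero u = [] ∷ []
  allVecs-unique {A = A} {xs = xs} (suc n) u =
    unique-concatMap extend id Vec.head xs (UniqueP.map⁺ id u)
      (λ _ → UniqueP.map⁺ VecP.∷-injectiveʳ (allVecs-unique n u)) headOf
    where
    extend : A → List (Vec A (suc n))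
    extend x = map (x Vec.∷_) (allVecs xs n)
    headOf : ∀ {x z} → x ∈ xs → z ∈ extend x → Vec.head z ≡ x
    headOf _ z∈ with ∈-map⁻ _ z∈
    ... | _ , _ , refl = refl

  allVecs-complete : {xs : List A} (n : ℕ) {v : Vec A n} →
                     All (_∈ xs) (toList v) → v ∈ allVecs xs n
  allVecs-complete zero {Vec.[]} _ = here refl
  allVecs-complete {xs = xs} (suc n) {x Vec.∷ v} (x∈ ∷ v∈) =
    ∈-concatMap-intro (λ x → map (x Vec.∷_) (allVecs xs n)) x∈
      (∈-map⁺ _ (allVecs-complete n v∈))

  length-filter-split : {P : A → Set} (P? : Decidable P) (xs : List A) →
    length (filter (λ x → ¬? (P? x)) xs) + length (filter P? xs) ≡ length xs
  length-filter-split P? [] = refl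
  length-filter-split P? (x ∷ xs) with P? x
  ... | yes _ = trans (+-suc _ _) (cong suc (length-filter-split P? xs))
  ... | no _ = cong suc (length-filter-split P? xs)

  module _ {n : ℕ} where
    open MemDec (_≟_ {n}) using (_∈?_)

    unique-↭-subset : {E : List (Fin n)} → Unique E → E ↭ filter (_∈? E) (allFin n)
    unique-↭-subset {E} u = unique-↭ u (UniqueP.filter⁺ (_∈? E) (UniqueP.allFin⁺ n))
      (λ z∈ → ∈-filter⁺ (_∈? E) (∈-allFin _) z∈)
      (λ z∈ → proj₂ (∈-filter⁻ (_∈? E) {xs = allFin n} z∈))

    complement-length : {E : List (Fin n)} → Unique E →
      length (filter (λ v → ¬? (v ∈? E)) (allFin n)) + length E ≡ n
    complement-length {E} u =
      trans (cong (length (filter (λ v → ¬? (v ∈? E)) (allFin n)) +_)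
                  (PermP.↭-length (unique-↭-subset u)))
        (trans (length-filter-split (_∈? E) (allFin n)) (ListP.length-tabulate id))

    unique-length≤ : {E : List (Fin n)} → Unique E → length E ≤ n
    unique-length≤ {E} u =
      subst (_≤ n) (sym (PermP.↭-length (unique-↭-subset u)))
        (subst (length (filter (_∈? E) (allFin n)) ≤_) (ListP.length-tabulate id)
          (ListP.length-filter (_∈? E) (allFin n)))

module Sums {c ℓ : Level} (R : CommutativeSemiring c ℓ) where

  open CommutativeSemiring R
  open import Function using (_∘_)
  open import Data.Nat using (_≟_)
  open import Data.List using (List; []; _∷_; _++_; concatMap; length; map; filter)
  import Data.List.Properties as ListP
  import Data.List.Relation.Unary.All as All
  open import Data.List.Relation.Unary.AllPairs using (_∷_)
  open import Data.List.Relation.Unary.Any using (here; there)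
  open import Data.List.Membership.Propositional using (_∈_)
  open import Data.List.Relation.Unary.Unique.Propositional using (Unique)
  open import Data.List.Relation.Binary.Permutation.Propositional as Perm using (_↭_)
  import Data.List.Relation.Binary.Permutation.Propositional.Properties as PermP
  import Data.List.Relation.Binary.Permutation.Setoid.Properties as PermSetoidP
  open import Data.Empty using (⊥-elim)
  open import Relation.Nullary using (yes; no)
  open import Relation.Binary.PropositionalEquality as ≡ using (_≡_)
  open import Relation.Binary.Reasoning.Setoid setoid
  open import Algebra.Properties.CommutativeSemigroup +-commutativeSemigroup
    using () renaming (x∙yz≈y∙xz to +-x∙yz≈y∙xz)
  open import Algebra.Properties.Semiring.Mult semiring public
    using (×-congʳ; ×-assocˡ; ×-comm-*)
    renaming (_×_ to _×ₙ_)
  open import Algebra.Properties.CommutativeMonoid.Mult +-commutativeMonoid public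
    using (×-distrib-+)

  private variable
    a : Level
    A B : Set a

  ∑ : (A → Carrier) → List A → Carrier
  ∑ f l = sumR R (map f l)

  ∑-cong : {f g : A → Carrier} (l : List A) → (∀ {x} → x ∈ l → f x ≈ g x) → ∑ f l ≈ ∑ g l
  ∑-cong [] _ = refl
  ∑-cong (x ∷ l) f≈g = +-cong (f≈g (here ≡.refl)) (∑-cong l (f≈g ∘ there))

  ∑-++ : (f : A → Carrier) (xs ys : List A) → ∑ f (xs ++ ys) ≈ ∑ f xs + ∑ f ys
  ∑-++ f [] ys = sym (+-identityˡ _)
  ∑-++ f (x ∷ xs) ys = trans (+-congˡ (∑-++ f xs ys)) (sym (+-assoc _ _ _))

  ∑-concatMap : (f : B → Carrier) (g : A → List B) (xs : List A) →
                ∑ f (concatMap g xs) ≈ ∑ (λ x → ∑ f (g x)) xs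
  ∑-concatMap f g [] = refl
  ∑-concatMap f g (x ∷ xs) = trans (∑-++ f (g x) (concatMap g xs)) (+-congˡ (∑-concatMap f g xs))

  ∑-map : (f : B → Carrier) (h : A → B) (xs : List A) → ∑ f (map h xs) ≡ ∑ (f ∘ h) xs
  ∑-map f h xs = ≡.cong (sumR R) (≡.sym (ListP.map-∘ xs))

  ∑-↭ : (f : A → Carrier) {xs ys : List A} → xs ↭ ys → ∑ f xs ≈ ∑ f ys
  ∑-↭ f p = PermSetoidP.foldr-commMonoid setoid +-isCommutativeMonoid
              (Perm.↭⇒↭ₛ′ isEquivalence (PermP.map⁺ f p))

  ∑-*ˡ : (a : Carrier) (f : A → Carrier) (xs : List A) → ∑ (λ x → a * f x) xs ≈ a * ∑ f xs
  ∑-*ˡ a f [] = sym (zeroʳ a)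
  ∑-*ˡ a f (x ∷ xs) = trans (+-congˡ (∑-*ˡ a f xs)) (sym (distribˡ a _ _))

  ∑-+ : (f g : A → Carrier) (xs : List A) → ∑ (λ x → f x + g x) xs ≈ ∑ f xs + ∑ g xs
  ∑-+ f g [] = sym (+-identityˡ 0#)
  ∑-+ f g (x ∷ xs) = begin
    (f x + g x) + ∑ (λ x → f x + g x) xs ≈⟨ +-congˡ (∑-+ f g xs) ⟩
    (f x + g x) + (∑ f xs + ∑ g xs)      ≈⟨ +-assoc _ _ _ ⟩
    f x + (g x + (∑ f xs + ∑ g xs))      ≈⟨ +-congˡ (+-x∙yz≈y∙xz (g x) (∑ f xs) (∑ g xs)) ⟩
    f x + (∑ f xs + (g x + ∑ g xs))      ≈⟨ sym (+-assoc _ _ _) ⟩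
    (f x + ∑ f xs) + (g x + ∑ g xs)      ∎

  ∑-zero : (f : A → Carrier) (xs : List A) → (∀ {x} → x ∈ xs → f x ≈ 0#) → ∑ f xs ≈ 0#
  ∑-zero f [] _ = refl
  ∑-zero f (x ∷ xs) f≈0 =
    trans (+-cong (f≈0 (here ≡.refl)) (∑-zero f xs (f≈0 ∘ there))) (+-identityˡ 0#)

  ∑-const : (f : A → Carrier) (xs : List A) {k : Carrier} →
            (∀ {x} → x ∈ xs → f x ≈ k) → ∑ f xs ≈ length xs ×ₙ k
  ∑-const f [] _ = refl
  ∑-const f (x ∷ xs) f≈k = +-cong (f≈k (here ≡.refl)) (∑-const f xs (f≈k ∘ there))

  module _ (κ : A → ℕ) (w : A → Carrier) (cf : ℕ → Carrier) where

    private
      contribution : A → ℕ → Carrier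
      contribution x k with κ x ≟ k
      ... | yes _ = w x * cf k
      ... | no _ = 0#

      group : List A → ℕ → Carrier
      group L k = ∑ w (filter (λ z → κ z ≟ k) L) * cf k

      contribution-∑ : ∀ x (ks : List ℕ) → Unique ks → κ x ∈ ks →
                       ∑ (contribution x) ks ≈ w x * cf (κ x)
      contribution-∑ x (k ∷ ks) (k∉ ∷ u) κx∈ with κ x ≟ k
      ... | yes ≡.refl = trans (+-congˡ (∑-zero (contribution x) ks elsewhere)) (+-identityʳ _)
        where
        elsewhere : ∀ {k'} → k' ∈ ks → contribution x k' ≈ 0#
        elsewhere {k'} k'∈ with κ x ≟ k'
        ... | yes ≡.refl = ⊥-elim (All.lookup k∉ k'∈ ≡.refl)
        ... | no _ = refl
      ... | no κx≢k with κx∈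
      ...   | here κx≡k = ⊥-elim (κx≢k κx≡k)
      ...   | there κx∈′ = trans (+-identityˡ _) (contribution-∑ x ks u κx∈′)

      group-∷ : ∀ x L k → group (x ∷ L) k ≈ contribution x k + group L k
      group-∷ x L k with κ x ≟ k
      ... | yes κx≡k = trans (*-congʳ (reflexive (≡.cong (∑ w) (ListP.filter-accept (λ z → κ z ≟ k) κx≡k))))
                             (distribʳ (cf k) (w x) _)
      ... | no κx≢k = trans (*-congʳ (reflexive (≡.cong (∑ w) (ListP.filter-reject (λ z → κ z ≟ k) κx≢k))))
                            (sym (+-identityˡ _))

    ∑-groupBy : (L : List A) (ks : List ℕ) → Unique ks → (∀ {x} → x ∈ L → κ x ∈ ks) →
                ∑ (λ k → ∑ w (filter (λ z → κ z ≟ k) L) * cf k) ks ≈ ∑ (λ x → w x * cf (κ x)) L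
    ∑-groupBy [] ks _ _ = ∑-zero _ ks (λ _ → zeroˡ _)
    ∑-groupBy (x ∷ L) ks u κ∈ = begin
      ∑ (group (x ∷ L)) ks                         ≈⟨ ∑-cong ks (λ {k} _ → group-∷ x L k) ⟩
      ∑ (λ k → contribution x k + group L k) ks    ≈⟨ ∑-+ _ _ ks ⟩
      ∑ (contribution x) ks + ∑ (group L) ks
        ≈⟨ +-cong (contribution-∑ x ks u (κ∈ (here ≡.refl))) (∑-groupBy L ks u (κ∈ ∘ there)) ⟩
      w x * cf (κ x) + ∑ (λ x → w x * cf (κ x)) L  ∎

-- The children lists of the new root in the forest recursion
-- are arrangements of the old roots.
module Arrangements where

  open import Data.Nat using (zero; suc; _≤_)
  import Data.Nat.Properties as ℕP
  open import Data.List as List using (List; []; _∷_; [_]; length; map; concatMap)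
  import Data.List.Properties as ListP
  open import Data.List.Relation.Unary.All as All using (All; []; _∷_)
  open import Data.List.Relation.Unary.Any using (here; there)
  open import Data.List.Relation.Unary.AllPairs using ([]; _∷_)
  open import Data.List.Membership.Propositional using (_∈_)
  open import Data.List.Membership.Propositional.Properties using (∈-map⁺; ∈-map⁻)
  open import Data.List.Relation.Unary.Unique.Propositional using (Unique)
  import Data.List.Relation.Unary.Unique.Propositional.Properties as UniqueP
  open import Data.List.Relation.Binary.Permutation.Propositional
    using (_↭_; ↭-refl; ↭-sym; ↭-trans; prep; swap)
  import Data.List.Relation.Binary.Permutation.Propositional.Properties as PermP
  open import Data.Product using (∃; _×_; _,_; proj₁; proj₂)
  open import Data.Empty using (⊥-elim)
  open import Data.Maybe using (just)
  open import Data.Maybe.Properties using (just-injective)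
  open import Relation.Binary.PropositionalEquality using (_≡_; _≢_; refl; sym; trans; cong; subst)
  open ListFacts

  private variable
    a : Level
    A : Set a

  picks : List A → List (A × List A)
  picks [] = []
  picks (x ∷ xs) = (x , xs) ∷ map (λ (y , r) → y , x ∷ r) (picks xs)

  picks-↭ : {xs : List A} {y : A} {r : List A} → (y , r) ∈ picks xs → xs ↭ y ∷ r
  picks-↭ {xs = x ∷ xs} (here refl) = ↭-refl
  picks-↭ {xs = x ∷ xs} (there m) with ∈-map⁻ _ m
  ... | (y , r) , m′ , refl = ↭-trans (prep x (picks-↭ m′)) (swap x y ↭-refl)

  picks-fst : (xs : List A) → map proj₁ (picks xs) ≡ xs
  picks-fst [] = refl
  picks-fst (x ∷ xs) = cong (x ∷_) (trans (sym (ListP.map-∘ (picks xs))) (picks-fst xs))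

  picks-length : (xs : List A) → length (picks xs) ≡ length xs
  picks-length xs = trans (sym (ListP.length-map proj₁ (picks xs))) (cong length (picks-fst xs))

  picks-complete : {xs : List A} {y : A} → y ∈ xs → ∃ λ r → (y , r) ∈ picks xs
  picks-complete {xs = x ∷ xs} (here refl) = xs , here refl
  picks-complete {xs = x ∷ xs} (there y∈) with picks-complete y∈
  ... | r , m = x ∷ r , there (∈-map⁺ _ m)

  picks-rest-length : {xs : List A} {y : A} {r : List A} →
                      (y , r) ∈ picks xs → length xs ≡ suc (length r)
  picks-rest-length m = PermP.↭-length (picks-↭ m)

  arrangements : ℕ → List A → List (List A)
  arrangements zero _ = [ [] ]
  arrangements (suc k) xs =
    [] ∷ concatMap (λ (y , r) → map (y ∷_) (arrangements k r)) (picks xs)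

  arrangements-sound : (k : ℕ) {xs c : List A} → Unique xs →
                       c ∈ arrangements k xs → Unique c × All (_∈ xs) c
  arrangements-sound zero u (here refl) = [] , []
  arrangements-sound (suc k) u (here refl) = [] , []
  arrangements-sound (suc k) {xs} u (there m)
    with ∈-concatMap-elim (λ (y , r) → map (y ∷_) (arrangements k r)) (picks xs) m
  ... | (y , r) , yr∈ , m′ with ∈-map⁻ _ m′ | Unique-resp-↭ (picks-↭ yr∈) u
  ... | c , c∈ , refl | y∉r ∷ ur with arrangements-sound k ur c∈
  ... | uc , c⊆r = All.map (λ z∈r y≡z → All.lookup y∉r (subst (_∈ r) (sym y≡z) z∈r) refl) c⊆r ∷ uc
                 , inXs (here refl) ∷ All.map (λ z∈r → inXs (there z∈r)) c⊆r
    where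
    inXs : ∀ {z} → z ∈ y ∷ r → z ∈ xs
    inXs = PermP.∈-resp-↭ (↭-sym (picks-↭ yr∈))

  arrangements-complete : (k : ℕ) {xs c : List A} → Unique xs → length xs ≤ k →
                          Unique c → All (_∈ xs) c → c ∈ arrangements k xs
  arrangements-complete zero u _ [] [] = here refl
  arrangements-complete (suc k) u _ [] [] = here refl
  arrangements-complete zero {[]} u _ (_ ∷ _) (() ∷ _)
  arrangements-complete (suc k) {xs} {y ∷ c} u xs≤ (y∉c ∷ uc) (y∈ ∷ c⊆) with picks-complete y∈
  ... | r , yr∈ with Unique-resp-↭ (picks-↭ yr∈) u
  ... | _ ∷ ur = there (∈-concatMap-intro (λ (y , r) → map (y ∷_) (arrangements k r)) yr∈
                   (∈-map⁺ (y ∷_) (arrangements-complete k ur r≤ uc c⊆r)))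
    where
    r≤ : length r ≤ k
    r≤ = ℕP.≤-pred (subst (_≤ suc k) (picks-rest-length yr∈) xs≤)
    inRest : ∀ {z} → z ∈ c → z ∈ y ∷ r → z ∈ r
    inRest z∈c (here refl) = ⊥-elim (All.lookup y∉c z∈c refl)
    inRest z∈c (there z∈r) = z∈r
    c⊆r : All (_∈ r) c
    c⊆r = All.tabulate λ z∈c → inRest z∈c (PermP.∈-resp-↭ (picks-↭ yr∈) (All.lookup c⊆ z∈c))

  arrangements-unique : (k : ℕ) {xs : List A} → Unique xs → Unique (arrangements k xs)
  arrangements-unique zero u = [] ∷ []
  arrangements-unique {A = A} (suc k) {xs} u =
    All.tabulate nonempty ∷
    unique-concatMap extend (λ p → just (proj₁ p)) List.head (picks xs) firstsUnique
      (λ yr∈ → UniqueP.map⁺ ListP.∷-injectiveʳ (arrangements-unique k (restUnique yr∈)))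
      headOf
    where
    extend : A × List A → List (List A)
    extend (y , r) = map (y ∷_) (arrangements k r)
    firstsUnique : Unique (map (λ p → just (proj₁ p)) (picks xs))
    firstsUnique = subst Unique (sym (ListP.map-∘ (picks xs)))
      (UniqueP.map⁺ just-injective (subst Unique (sym (picks-fst xs)) u))
    restUnique : ∀ {p} → p ∈ picks xs → Unique (proj₂ p)
    restUnique yr∈ with Unique-resp-↭ (picks-↭ yr∈) u
    ... | _ ∷ ur = ur
    headOf : ∀ {p z} → p ∈ picks xs → z ∈ extend p → List.head z ≡ just (proj₁ p)
    headOf _ z∈ with ∈-map⁻ _ z∈
    ... | _ , _ , refl = refl
    nonempty : ∀ {z} → z ∈ concatMap extend (picks xs) → [] ≢ z
    nonempty z∈ refl with ∈-concatMap-elim extend (picks xs) z∈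
    ... | p , p∈ , m with headOf p∈ m
    ... | ()

module ArrangementSums {c ℓ : Level} (R : CommutativeSemiring c ℓ) where

  open CommutativeSemiring R
  open import Function using (_∘_)
  open import Data.Nat as ℕ using (zero; suc; _≤_; _∸_)
  import Data.Nat.Properties as ℕP
  open import Data.List using (List; []; _∷_; length; map)
  open import Data.List.Membership.Propositional using (_∈_)
  open import Data.Product using (_,_; proj₂)
  open import Relation.Binary.PropositionalEquality as ≡ using (_≡_)
  open import Relation.Binary.Reasoning.Setoid setoid
  open Sums R
  open Arrangements

  private variable
    a : Level
    A : Set a

  arrangementSum : ℕ → List A → (ℕ → Carrier) → Carrier
  arrangementSum k xs ψ = ∑ (ψ ∘ length) (arrangements k xs)

  arrangementSum-suc : (k : ℕ) (xs : List A) (ψ : ℕ → Carrier) →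
    arrangementSum (suc k) xs ψ ≈ ψ 0 + ∑ (λ (_ , r) → arrangementSum k r (ψ ∘ suc)) (picks xs)
  arrangementSum-suc {A = A} k xs ψ =
    +-congˡ (trans (∑-concatMap (ψ ∘ length) extend (picks xs))
                   (∑-cong (picks xs) λ {(y , r)} _ → reflexive (∑-map (ψ ∘ length) (y ∷_) (arrangements k r))))
    where
    extend : A × List A → List (List A)
    extend (y , r) = map (y ∷_) (arrangements k r)

  arrangementSum-deg0 : (k : ℕ) (xs : List A) (ψ : ℕ → Carrier) →
    (∀ j → ψ j ≈ 0#) → arrangementSum k xs ψ ≈ 0#
  arrangementSum-deg0 k xs ψ ψ≈0 = ∑-zero (ψ ∘ length) (arrangements k xs) (λ {c} _ → ψ≈0 (length c))

  arrangementSum-deg1 : (k : ℕ) (xs : List A) (ψ : ℕ → Carrier) →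
    (∀ j → ψ (suc j) ≈ 0#) → arrangementSum k xs ψ ≈ ψ 0
  arrangementSum-deg1 zero xs ψ _ = +-identityʳ _
  arrangementSum-deg1 (suc k) xs ψ ψ≈0 = begin
    arrangementSum (suc k) xs ψ ≈⟨ arrangementSum-suc k xs ψ ⟩
    ψ 0 + ∑ (λ (_ , r) → arrangementSum k r (ψ ∘ suc)) (picks xs)
      ≈⟨ +-congˡ (∑-zero _ (picks xs) λ {(_ , r)} _ → arrangementSum-deg0 k r (ψ ∘ suc) ψ≈0) ⟩
    ψ 0 + 0# ≈⟨ +-identityʳ _ ⟩
    ψ 0 ∎

  arrangementSum-deg2 : (k : ℕ) (xs : List A) (ψ : ℕ → Carrier) →
    (∀ j → ψ (suc (suc j)) ≈ 0#) → length xs ≤ k →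
    arrangementSum k xs ψ ≈ ψ 0 + length xs ×ₙ ψ 1
  arrangementSum-deg2 zero [] ψ _ _ = refl
  arrangementSum-deg2 (suc k) xs ψ ψ≈0 _ = begin
    arrangementSum (suc k) xs ψ ≈⟨ arrangementSum-suc k xs ψ ⟩
    ψ 0 + ∑ (λ (_ , r) → arrangementSum k r (ψ ∘ suc)) (picks xs)
      ≈⟨ +-congˡ (∑-const _ (picks xs) λ {(_ , r)} _ → arrangementSum-deg1 k r (ψ ∘ suc) ψ≈0) ⟩
    ψ 0 + length (picks xs) ×ₙ ψ 1 ≡⟨ ≡.cong (λ m → ψ 0 + m ×ₙ ψ 1) (picks-length xs) ⟩
    ψ 0 + length xs ×ₙ ψ 1 ∎

  arrangementSum-deg3 : (k : ℕ) (xs : List A) (ψ : ℕ → Carrier) →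
    (∀ j → ψ (suc (suc (suc j))) ≈ 0#) → length xs ≤ k →
    let m = length xs in
    arrangementSum k xs ψ ≈ ψ 0 + (m ×ₙ ψ 1 + (m ℕ.* (m ∸ 1)) ×ₙ ψ 2)
  arrangementSum-deg3 zero [] ψ _ _ = +-congˡ (sym (+-identityˡ 0#))
  arrangementSum-deg3 (suc k) xs ψ ψ≈0 xs≤ = begin
    arrangementSum (suc k) xs ψ ≈⟨ arrangementSum-suc k xs ψ ⟩
    ψ 0 + ∑ (λ (_ , r) → arrangementSum k r (ψ ∘ suc)) (picks xs) ≈⟨ +-congˡ (∑-const _ (picks xs) rest) ⟩
    ψ 0 + length (picks xs) ×ₙ (ψ 1 + (m ∸ 1) ×ₙ ψ 2)
      ≡⟨ ≡.cong (λ n → ψ 0 + n ×ₙ (ψ 1 + (m ∸ 1) ×ₙ ψ 2)) (picks-length xs) ⟩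
    ψ 0 + m ×ₙ (ψ 1 + (m ∸ 1) ×ₙ ψ 2)   ≈⟨ +-congˡ (×-distrib-+ _ _ m) ⟩
    ψ 0 + (m ×ₙ ψ 1 + m ×ₙ ((m ∸ 1) ×ₙ ψ 2)) ≈⟨ +-congˡ (+-congˡ (×-assocˡ (ψ 2) m (m ∸ 1))) ⟩
    ψ 0 + (m ×ₙ ψ 1 + (m ℕ.* (m ∸ 1)) ×ₙ ψ 2) ∎
    where
    m = length xs
    rest : ∀ {p} → p ∈ picks xs → arrangementSum k (proj₂ p) (ψ ∘ suc) ≈ ψ 1 + (m ∸ 1) ×ₙ ψ 2
    rest {y , r} yr∈ = begin
      arrangementSum k r (ψ ∘ suc) ≈⟨ arrangementSum-deg2 k r (ψ ∘ suc) ψ≈0 r≤ ⟩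
      ψ 1 + length r ×ₙ ψ 2 ≡⟨ ≡.cong (λ n → ψ 1 + n ×ₙ ψ 2) (≡.cong (_∸ 1) (≡.sym (picks-rest-length yr∈))) ⟩
      ψ 1 + (m ∸ 1) ×ₙ ψ 2 ∎
      where r≤ = ℕP.≤-pred (≡.subst (_≤ suc k) (picks-rest-length yr∈) xs≤)

-- Increasing ordered forests on Fin (n+1) arise exactly once from a forest
-- on Fin n (relabelled i ↦ i+1) by adding the new minimal vertex 0 as a
-- root whose ordered list of children is an arrangement of some of the
-- old roots ("grafting").
module Forests where

  open import Function using (_∘_)
  open import Data.Nat using (suc; _+_; _∸_; _≤_; _<_; z≤n; s≤s)
  import Data.Nat.Properties as ℕP
  open import Data.Fin as Fin using (Fin; toℕ)
  import Data.Fin.Properties as FinP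
  open import Data.List as List using (List; []; _∷_; _++_; concat; length; map; allFin)
  import Data.List.Properties as ListP
  open import Data.List.Relation.Unary.All as All using (All; []; _∷_)
  import Data.List.Relation.Unary.All.Properties as AllP
  open import Data.List.Membership.Propositional using (_∈_; _∉_)
  open import Data.List.Membership.Propositional.Properties
    using (∈-map⁺; ∈-map⁻; ∈-filter⁺; ∈-filter⁻; ∈-allFin)
  open import Data.List.Relation.Unary.Unique.Propositional using (Unique)
  import Data.List.Relation.Unary.Unique.Propositional.Properties as UniqueP
  open import Data.List.Relation.Binary.Permutation.Propositional using (_↭_)
  open import Data.Vec as Vec using (Vec; toList; lookup)
  import Data.Vec.Properties as VecP
  open import Data.Product using (∃; _×_; _,_; proj₂)
  open import Relation.Nullary using (¬_)
  open import Relation.Binary.PropositionalEquality using (_≡_; refl; sym; trans; cong; cong₂; subst)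
  open ListFacts
  open Enumerations
  open Arrangements

  module _ {n : ℕ} where

    -- Each vertex has at most one parent, so the number of trees is n minus
    -- the number of child edges.
    numTrees+edges : (ch : Children n) → Unique (allChildEdges ch) →
                     numTrees ch + length (allChildEdges ch) ≡ n
    numTrees+edges ch = complement-length

    numTrees≤ : (ch : Children n) → numTrees ch ≤ n
    numTrees≤ ch = unique-length≤ (UniqueP.filter⁺ _ (UniqueP.allFin⁺ n))

    roots-unique : (ch : Children n) → Unique (roots ch)
    roots-unique ch = UniqueP.filter⁺ _ (UniqueP.allFin⁺ n)

    root⇒notChild : (ch : Children n) {v : Fin n} → v ∈ roots ch → v ∉ allChildEdges ch
    root⇒notChild ch v∈ = proj₂ (∈-filter⁻ _ {xs = allFin n} v∈)

    notChild⇒root : (ch : Children n) {v : Fin n} → v ∉ allChildEdges ch → v ∈ roots ch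
    notChild⇒root ch {v} v∉ = ∈-filter⁺ _ (∈-allFin v) v∉

    incOrdForests-unique : Unique (incOrdForests n)
    incOrdForests-unique =
      UniqueP.filter⁺ isIncOrdForest? (allVecs-unique n (allLists-unique n (UniqueP.allFin⁺ n)))

    incOrdForests-sound : {ch : Children n} → ch ∈ incOrdForests n → IsIncOrdForest ch
    incOrdForests-sound ch∈ =
      proj₂ (∈-filter⁻ isIncOrdForest? {xs = allVecs (allLists (allFin n) n) n} ch∈)

    -- a child list has distinct entries, hence at most n of them
    incOrdForests-complete : {ch : Children n} → IsIncOrdForest ch → ch ∈ incOrdForests n
    incOrdForests-complete {ch} forest@(_ , uE) =
      ∈-filter⁺ isIncOrdForest?
        (allVecs-complete n (All.tabulate λ {l} l∈ →
          allLists-complete n (All.tabulate (λ _ → ∈-allFin _))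
            (unique-length≤ (unique-concat (toList ch) uE l∈))))
        forest

  module _ {n : ℕ} where

    relabel : List (Fin n) → List (Fin (suc n))
    relabel = map Fin.suc

    unrelabel : List (Fin (suc n)) → List (Fin n)
    unrelabel [] = []
    unrelabel (Fin.zero ∷ l) = unrelabel l
    unrelabel (Fin.suc i ∷ l) = i ∷ unrelabel l

    Positive : List (Fin (suc n)) → Set
    Positive = All (λ w → 0 < toℕ w)

    unrelabel-relabel : (l : List (Fin n)) → unrelabel (relabel l) ≡ l
    unrelabel-relabel [] = refl
    unrelabel-relabel (x ∷ l) = cong (x ∷_) (unrelabel-relabel l)

    relabel-unrelabel : (l : List (Fin (suc n))) → Positive l → relabel (unrelabel l) ≡ l
    relabel-unrelabel [] _ = refl
    relabel-unrelabel (Fin.suc i ∷ l) (_ ∷ pos) = cong (Fin.suc i ∷_) (relabel-unrelabel l pos)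

    relabel-increasing : (v : Fin n) (l : List (Fin (suc n))) →
      All (λ w → toℕ (Fin.suc v) < toℕ w) l → All (λ w → toℕ v < toℕ w) (unrelabel l)
    relabel-increasing v [] _ = []
    relabel-increasing v (Fin.suc i ∷ l) (s≤s v<i ∷ inc) = v<i ∷ relabel-increasing v l inc

    relabelForest : {m : ℕ} → Vec (List (Fin n)) m → Vec (List (Fin (suc n))) m
    relabelForest = Vec.map relabel

    unrelabelForest : {m : ℕ} → Vec (List (Fin (suc n))) m → Vec (List (Fin n)) m
    unrelabelForest = Vec.map unrelabel

    unrelabel-relabelForest : {m : ℕ} (v : Vec (List (Fin n)) m) →
                              unrelabelForest (relabelForest v) ≡ v
    unrelabel-relabelForest Vec.[] = refl
    unrelabel-relabelForest (l Vec.∷ v) = cong₂ Vec._∷_ (unrelabel-relabel l) (unrelabel-relabelForest v)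

    relabel-unrelabelForest : {m : ℕ} (v : Vec (List (Fin (suc n))) m) →
      (∀ i → Positive (lookup v i)) → relabelForest (unrelabelForest v) ≡ v
    relabel-unrelabelForest Vec.[] _ = refl
    relabel-unrelabelForest (l Vec.∷ v) pos =
      cong₂ Vec._∷_ (relabel-unrelabel l (pos Fin.zero)) (relabel-unrelabelForest v (pos ∘ Fin.suc))

    edges-relabel : {m : ℕ} (v : Vec (List (Fin n)) m) →
                    concat (toList (relabelForest v)) ≡ relabel (concat (toList v))
    edges-relabel Vec.[] = refl
    edges-relabel (l Vec.∷ v) =
      trans (cong (relabel l ++_) (edges-relabel v)) (sym (ListP.map-++ Fin.suc l _))

    relabel-unique : {l : List (Fin n)} → Unique l → Unique (relabel l)
    relabel-unique = UniqueP.map⁺ FinP.suc-injective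

    graft : Children n → List (Fin (suc n)) → Children (suc n)
    graft ch c = c Vec.∷ relabelForest ch

    newChildren : Children n → List (List (Fin (suc n)))
    newChildren ch = arrangements n (relabel (roots ch))

    grafts : Children n → List (Children (suc n))
    grafts ch = map (graft ch) (newChildren ch)

    prune : Children (suc n) → Children n
    prune (_ Vec.∷ tl) = unrelabelForest tl

    grafts-unique : (ch : Children n) → Unique (grafts ch)
    grafts-unique ch = UniqueP.map⁺ (λ { refl → refl })
                         (arrangements-unique n (relabel-unique (roots-unique ch)))

    prune-grafts : {ch : Children n} {z : Children (suc n)} → z ∈ grafts ch → prune z ≡ ch
    prune-grafts {ch} z∈ with ∈-map⁻ _ z∈
    ... | _ , _ , refl = unrelabel-relabelForest ch

    grafts-sound : {ch : Children n} {z : Children (suc n)} →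
                   IsIncOrdForest ch → z ∈ grafts ch → IsIncOrdForest z
    grafts-sound {ch} (increasing , uE) z∈ with ∈-map⁻ _ z∈
    ... | c , c∈ , refl with arrangements-sound n (relabel-unique (roots-unique ch)) c∈
    ... | uc , c⊆roots =
      increasing′ ,
      subst Unique (sym (cong (c ++_) (edges-relabel ch)))
        (UniqueP.++⁺ uc (relabel-unique uE) disjoint)
      where
      positive : ∀ {w} → (∃ λ u → u ∈ roots ch × w ≡ Fin.suc u) → 0 < toℕ w
      positive (_ , _ , refl) = s≤s z≤n
      increasing′ : ∀ (v : Fin (suc n)) → All (λ w → toℕ v < toℕ w) (lookup (graft ch c) v)
      increasing′ Fin.zero = All.map (λ w∈ → positive (∈-map⁻ Fin.suc w∈)) c⊆roots
      increasing′ (Fin.suc v) =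
        subst (All (λ w → toℕ (Fin.suc v) < toℕ w)) (sym (VecP.lookup-map v relabel ch))
          (AllP.map⁺ (All.map s≤s (increasing v)))
      disjoint : ∀ {w} → ¬ (w ∈ c × w ∈ relabel (allChildEdges ch))
      disjoint (w∈c , w∈E) with ∈-map⁻ Fin.suc (All.lookup c⊆roots w∈c) | ∈-map⁻ Fin.suc w∈E
      ... | u , u∈roots , refl | u′ , u′∈E , eq =
        root⇒notChild ch u∈roots (subst (_∈ allChildEdges ch) (sym (FinP.suc-injective eq)) u′∈E)

    grafts-complete : {z : Children (suc n)} → IsIncOrdForest z →
                      ∃ λ ch → ch ∈ incOrdForests n × z ∈ grafts ch
    grafts-complete {c Vec.∷ tl} (increasing , u) =
      ch , incOrdForests-complete (increasing′ , uE) , subst (λ t → (c Vec.∷ t) ∈ grafts ch) tl≡ c∈grafts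
      where
      ch = unrelabelForest tl
      tl≡ : relabelForest ch ≡ tl
      tl≡ = relabel-unrelabelForest tl λ i → All.map (ℕP.<-trans (s≤s z≤n)) (increasing (Fin.suc i))
      increasing′ : ∀ (v : Fin n) → All (λ w → toℕ v < toℕ w) (lookup ch v)
      increasing′ v = subst (All (λ w → toℕ v < toℕ w)) (sym (VecP.lookup-map v unrelabel tl))
                        (relabel-increasing v (lookup tl v) (increasing (Fin.suc v)))
      tl-edges : concat (toList tl) ≡ relabel (allChildEdges ch)
      tl-edges = trans (cong (λ t → concat (toList t)) (sym tl≡)) (edges-relabel ch)
      uE : Unique (allChildEdges ch)
      uE = UniqueP.map⁻ (subst Unique tl-edges (unique-++ʳ c u))
      childOf0 : ∀ w → w ∈ c → 0 < toℕ w → w ∈ relabel (roots ch)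
      childOf0 (Fin.suc v) w∈c _ = ∈-map⁺ Fin.suc (notChild⇒root ch λ v∈E →
        unique-++-disjoint c u w∈c (subst (Fin.suc v ∈_) (sym tl-edges) (∈-map⁺ Fin.suc v∈E)))
      c∈ : c ∈ newChildren ch
      c∈ = arrangements-complete n (relabel-unique (roots-unique ch))
             (subst (_≤ n) (sym (ListP.length-map Fin.suc (roots ch))) (numTrees≤ ch))
             (unique-++ˡ c u)
             (All.tabulate λ {w} w∈c → childOf0 w w∈c (All.lookup (increasing Fin.zero) w∈c))
      c∈grafts : graft ch c ∈ grafts ch
      c∈grafts = ∈-map⁺ (graft ch) c∈

    -- the roots of ch not adopted by 0 stay roots, and 0 is a new root
    numTrees-graft : {ch : Children n} {c : List (Fin (suc n))} → IsIncOrdForest ch →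
                     c ∈ newChildren ch → numTrees (graft ch c) ≡ suc (numTrees ch) ∸ length c
    numTrees-graft {ch} {c} forest@(_ , uE) c∈ =
      trans (sym (ℕP.m+n∸n≡m (numTrees z) (length c))) (cong (_∸ length c) counted)
      where
      z = graft ch c
      E = allChildEdges ch
      z-edges : length (allChildEdges z) ≡ length c + length E
      z-edges = trans (ListP.length-++ c)
                  (cong (length c +_) (trans (cong length (edges-relabel ch)) (ListP.length-map Fin.suc E)))
      z-count : numTrees z + (length c + length E) ≡ suc n
      z-count = trans (cong (numTrees z +_) (sym z-edges))
                  (numTrees+edges z (proj₂ (grafts-sound forest (∈-map⁺ (graft ch) c∈))))
      counted : numTrees z + length c ≡ suc (numTrees ch)
      counted = ℕP.+-cancelʳ-≡ (length E) _ _
        (trans (ℕP.+-assoc (numTrees z) (length c) (length E))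
          (trans z-count (cong suc (sym (numTrees+edges ch uE)))))

    deg-graft : (ch : Children n) (c : List (Fin (suc n))) (v : Fin n) →
                deg (graft ch c) (Fin.suc v) ≡ deg ch v
    deg-graft ch c v =
      trans (cong length (VecP.lookup-map v relabel ch)) (ListP.length-map Fin.suc (lookup ch v))

    incOrdForests-decomposition : incOrdForests (suc n) ↭ List.concatMap grafts (incOrdForests n)
    incOrdForests-decomposition =
      decomposition-↭ grafts prune incOrdForests-unique incOrdForests-unique
        (λ _ → grafts-unique _) (λ _ → prune-grafts)
        (λ ch∈ z∈ → incOrdForests-complete (grafts-sound (incOrdForests-sound ch∈) z∈))
        (λ z∈ → grafts-complete (incOrdForests-sound z∈))

module Recurrence {c ℓ : Level} (R : CommutativeSemiring c ℓ) where

  open CommutativeSemiring R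
  open import Data.Nat as ℕ using (zero; suc; _∸_)
  open Sums R using (_×ₙ_)

  D : (ℕ → Carrier) → (ℕ → Carrier) → ℕ → Carrier
  D φ h t = φ 0 * h (suc t) + (t ×ₙ (φ 1 * h t) + (t ℕ.* (t ∸ 1)) ×ₙ (φ 2 * h (t ∸ 1)))

  iterateD : (ℕ → Carrier) → ℕ → (ℕ → Carrier) → Carrier
  iterateD φ zero h = h 0
  iterateD φ (suc n) h = iterateD φ n (D φ h)

  recurrence-solution : (φ : ℕ → Carrier) (T : ℕ → (ℕ → Carrier) → Carrier) →
    (∀ h → T 0 h ≈ h 0) → (∀ n h → T (suc n) h ≈ T n (D φ h)) →
    ∀ n h → T n h ≈ iterateD φ n h
  recurrence-solution φ T base step zero h = base h
  recurrence-solution φ T base step (suc n) h =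
    trans (step n h) (recurrence-solution φ T base step n (D φ h))

module ForestRecurrence {c ℓ : Level} (R : CommutativeSemiring c ℓ) where

  open CommutativeSemiring R
  open import Function using (_∘_; id)
  open import Data.Nat as ℕ using (suc; _≤_; _∸_; s≤s)
  open import Data.Fin as Fin using (Fin)
  open import Data.List using (List; length; map; concatMap; upTo)
  import Data.List.Properties as ListP
  open import Data.List.Membership.Propositional using (_∈_)
  open import Data.List.Membership.Propositional.Properties using (∈-upTo⁺)
  import Data.List.Relation.Unary.Unique.Propositional.Properties as UniqueP
  open import Relation.Binary.PropositionalEquality as ≡ using (_≡_)
  open import Relation.Binary.Reasoning.Setoid setoid
  open Sums R
  open ArrangementSums R
  open Recurrence R
  open Forests

  forestSum : (ℕ → Carrier) → ℕ → (ℕ → Carrier) → Carrier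
  forestSum φ n h = ∑ (λ F → forestWeight R φ F * h (numTrees F)) (incOrdForests n)

  -- the empty forest is the only forest on Fin 0
  forestSum-zero : (φ : ℕ → Carrier) (h : ℕ → Carrier) → forestSum φ 0 h ≈ h 0
  forestSum-zero φ h = trans (+-identityʳ _) (*-identityˡ _)

  -- the new vertex contributes φ_{|c|}; all other degrees are unchanged
  forestWeight-graft : (φ : ℕ → Carrier) {n : ℕ} (ch : Children n) (c : List (Fin (suc n))) →
                       forestWeight R φ (graft ch c) ≡ φ (length c) * forestWeight R φ ch
  forestWeight-graft φ ch c = ≡.cong (λ l → φ (length c) * prodR R l)
    (≡.trans (ListP.map-tabulate Fin.suc (λ v → φ (deg (graft ch c) v)))
    (≡.trans (ListP.tabulate-cong (λ v → ≡.cong φ (deg-graft ch c v)))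
             (≡.sym (ListP.map-tabulate id (λ v → φ (deg ch v))))))

  module _ (φ : ℕ → Carrier) (φ-deg≤2 : ∀ j → φ (suc (suc (suc j))) ≈ 0#) where

    -- Summing over the grafts of one forest with t trees: choosing j of
    -- the t roots in order gives weight φ_j and t + 1 - j trees.
    ∑-grafts : {n : ℕ} (ch : Children n) (h : ℕ → Carrier) → IsIncOrdForest ch →
      ∑ (λ F → forestWeight R φ F * h (numTrees F)) (grafts ch)
        ≈ forestWeight R φ ch * D φ h (numTrees ch)
    ∑-grafts {n} ch h forest = begin
      ∑ G (grafts ch)                          ≡⟨ ∑-map G (graft ch) (newChildren ch) ⟩
      ∑ (G ∘ graft ch) (newChildren ch)        ≈⟨ ∑-cong (newChildren ch) graftTerm ⟩
      ∑ (λ c → w * ψ (length c)) (newChildren ch) ≈⟨ ∑-*ˡ w (ψ ∘ length) (newChildren ch) ⟩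
      w * arrangementSum n rs ψ
        ≈⟨ *-congˡ (arrangementSum-deg3 n rs ψ (λ j → trans (*-congʳ (φ-deg≤2 j)) (zeroˡ _)) rs≤) ⟩
      w * (ψ 0 + (length rs ×ₙ ψ 1 + (length rs ℕ.* (length rs ∸ 1)) ×ₙ ψ 2))
        ≡⟨ ≡.cong (λ m → w * (ψ 0 + (m ×ₙ ψ 1 + (m ℕ.* (m ∸ 1)) ×ₙ ψ 2))) rs-length ⟩
      w * D φ h t ∎
      where
      G : Children (suc n) → Carrier
      G F = forestWeight R φ F * h (numTrees F)
      rs = relabel (roots ch)
      t = numTrees ch
      w = forestWeight R φ ch
      ψ : ℕ → Carrier
      ψ j = φ j * h (suc t ∸ j)
      rs-length : length rs ≡ t
      rs-length = ListP.length-map Fin.suc (roots ch)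
      rs≤ : length rs ≤ n
      rs≤ = ≡.subst (_≤ n) (≡.sym rs-length) (numTrees≤ ch)
      graftTerm : ∀ {c} → c ∈ newChildren ch → G (graft ch c) ≈ w * ψ (length c)
      graftTerm {c} c∈ = begin
        forestWeight R φ (graft ch c) * h (numTrees (graft ch c))
          ≡⟨ ≡.cong₂ _*_ (forestWeight-graft φ ch c) (≡.cong h (numTrees-graft {ch = ch} forest c∈)) ⟩
        (φ (length c) * w) * h (suc t ∸ length c) ≈⟨ *-congʳ (*-comm _ _) ⟩
        (w * φ (length c)) * h (suc t ∸ length c) ≈⟨ *-assoc _ _ _ ⟩
        w * ψ (length c) ∎

    -- the recurrence step: group the forests on Fin (n+1) by the pruned forest
    forestSum-suc : (n : ℕ) (h : ℕ → Carrier) → forestSum φ (suc n) h ≈ forestSum φ n (D φ h)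
    forestSum-suc n h = begin
      forestSum φ (suc n) h                       ≈⟨ ∑-↭ G incOrdForests-decomposition ⟩
      ∑ G (concatMap grafts (incOrdForests n))    ≈⟨ ∑-concatMap G grafts (incOrdForests n) ⟩
      ∑ (λ ch → ∑ G (grafts ch)) (incOrdForests n)
        ≈⟨ ∑-cong (incOrdForests n) (λ ch∈ → ∑-grafts _ h (incOrdForests-sound ch∈)) ⟩
      forestSum φ n (D φ h) ∎
      where
      G : Children (suc n) → Carrier
      G F = forestWeight R φ F * h (numTrees F)

    forestSum-iterateD : (n : ℕ) (h : ℕ → Carrier) → forestSum φ n h ≈ iterateD φ n h
    forestSum-iterateD = recurrence-solution φ (forestSum φ) (forestSum-zero φ) forestSum-suc

  -- the generic Lah polynomial is the forest sum at h = y^(-): group the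
  -- forests by their number of trees k ≤ n
  LahPolyGen-forestSum : (φ : ℕ → Carrier) (y : Carrier) (n : ℕ) →
                         LahPolyGen R φ y n ≈ forestSum φ n (pow R y)
  LahPolyGen-forestSum φ y n =
    ∑-groupBy numTrees (forestWeight R φ) (pow R y) (incOrdForests n) (upTo (suc n)) (UniqueP.upTo⁺ (suc n))
      (λ {F} _ → ∈-upTo⁺ (s≤s (numTrees≤ F)))

-- List partitions of Fin (n+1) arise exactly once from a list partition
-- of Fin n (relabelled i ↦ i+1) by inserting the new minimal element 0 in
-- one of four ways: as a new singleton block [0]; in front of a block;
-- at the end of a block; or joining two blocks x, y into x ++ 0 ∷ y.
-- Blocks are kept sorted by their first elements, so the inverse map
-- (delete 0, split its block, re-sort) recovers the partition.
module ListPartitions where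

  open import Function using (_∘_)
  open import Data.Nat using (suc; _≤_; _<_; z≤n; s≤s)
  import Data.Nat.Properties as ℕP
  open import Data.Fin as Fin using (Fin; toℕ; _≟_)
  import Data.Fin.Properties as FinP
  open import Data.List using (List; []; _∷_; [_]; _++_; concat; concatMap; length; map; head; allFin)
  import Data.List.Properties as ListP
  open import Data.List.Relation.Unary.All as All using (All; []; _∷_)
  import Data.List.Relation.Unary.All.Properties as AllP
  open import Data.List.Relation.Unary.Any using (here; there)
  open import Data.List.Relation.Unary.AllPairs as AllPairs using (AllPairs; []; _∷_)
  import Data.List.Relation.Unary.AllPairs.Properties as AllPairsP
  open import Data.List.Relation.Unary.Linked using (Linked)
  import Data.List.Relation.Unary.Linked.Properties as LinkedP
  open import Data.List.Relation.Binary.Pointwise using (Pointwise; []; _∷_)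
  open import Data.List.Membership.Propositional using (_∈_; _∉_)
  import Data.List.Membership.DecPropositional as MemDec
  open import Data.List.Membership.Propositional.Properties
    using (∈-map⁺; ∈-map⁻; ∈-++⁺ˡ; ∈-++⁺ʳ; ∈-++⁻; ∈-concat⁺′; ∈-concat⁻′; ∈-∃++; ∈-filter⁺; ∈-filter⁻; ∈-allFin)
  open import Data.List.Relation.Unary.Unique.Propositional using (Unique)
  import Data.List.Relation.Unary.Unique.Propositional.Properties as UniqueP
  open import Data.List.Relation.Binary.Permutation.Propositional as Perm
    using (_↭_; ↭-refl; ↭-sym; ↭-trans; prep; swap)
  import Data.List.Relation.Binary.Permutation.Propositional.Properties as PermP
  open import Data.Product using (∃; _×_; _,_; proj₁; proj₂)
  open import Data.Sum using (_⊎_; inj₁; inj₂)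
  open import Data.Empty using (⊥; ⊥-elim)
  open import Data.Unit using (tt)
  open import Data.Maybe using (just)
  open import Data.Maybe.Properties using (just-injective)
  open import Relation.Nullary using (¬_; yes; no)
  open import Relation.Binary using (tri<; tri≈; tri>)
  open import Relation.Binary.PropositionalEquality
    using (_≡_; _≢_; refl; sym; trans; cong; cong₂; subst)
  open ListFacts
  open Enumerations
  open Arrangements using (picks; picks-↭; picks-fst; picks-complete)
  open Forests using (relabel; unrelabel; Positive; unrelabel-relabel; relabel-unrelabel)

  private variable
    a ℓ : Level
    A : Set a

  modifyEach : (A → A) → List A → List (List A)
  modifyEach g [] = []
  modifyEach g (x ∷ xs) = (g x ∷ xs) ∷ map (x ∷_) (modifyEach g xs)

  modifyEach-length : (g : A → A) (xs : List A) → length (modifyEach g xs) ≡ length xs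
  modifyEach-length g [] = refl
  modifyEach-length g (x ∷ xs) =
    cong suc (trans (ListP.length-map (x ∷_) (modifyEach g xs)) (modifyEach-length g xs))

  modifyEach-↭ : (g : A → A) {xs z : List A} → z ∈ modifyEach g xs →
                 ∃ λ x → ∃ λ r → (x , r) ∈ picks xs × z ↭ g x ∷ r
  modifyEach-↭ g {x ∷ xs} (here refl) = x , xs , here refl , ↭-refl
  modifyEach-↭ g {x ∷ xs} (there z∈) with ∈-map⁻ (x ∷_) z∈
  ... | z′ , z′∈ , refl with modifyEach-↭ g z′∈
  ... | y , r , yr∈ , z′↭ =
    y , x ∷ r , there (∈-map⁺ _ yr∈) , ↭-trans (prep x z′↭) (swap x (g y) ↭-refl)

  modifyEach-complete : (g : A → A) {xs : List A} {x : A} {r : List A} → (x , r) ∈ picks xs →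
                        ∃ λ z → z ∈ modifyEach g xs × z ↭ g x ∷ r
  modifyEach-complete g {y ∷ xs} (here refl) = _ , here refl , ↭-refl
  modifyEach-complete g {y ∷ xs} {x} (there xr∈) with ∈-map⁻ _ xr∈
  ... | _ , xr∈′ , refl with modifyEach-complete g xr∈′
  ... | z , z∈ , z↭ = y ∷ z , there (∈-map⁺ _ z∈) , ↭-trans (prep y z↭) (swap y (g x) ↭-refl)

  modifyEach-pointwise : {S : A → A → Set ℓ} (g : A → A) →
    (∀ x → S x x) → (∀ x → S x (g x)) → {xs z : List A} → z ∈ modifyEach g xs → Pointwise S xs z
  modifyEach-pointwise g S-refl S-g {x ∷ xs} (here refl) = S-g x ∷ reflexive xs
    where
    reflexive : ∀ xs → Pointwise _ xs xs
    reflexive [] = []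
    reflexive (y ∷ ys) = S-refl y ∷ reflexive ys
  modifyEach-pointwise g S-refl S-g {x ∷ xs} (there z∈) with ∈-map⁻ (x ∷_) z∈
  ... | _ , z′∈ , refl = S-refl x ∷ modifyEach-pointwise g S-refl S-g z′∈

  modifyEach-unique : (g : A → A) → (∀ x → g x ≢ x) → (xs : List A) → Unique (modifyEach g xs)
  modifyEach-unique g moves [] = []
  modifyEach-unique g moves (x ∷ xs) =
    All.tabulate firstDiffers ∷ UniqueP.map⁺ ListP.∷-injectiveʳ (modifyEach-unique g moves xs)
    where
    firstDiffers : ∀ {z} → z ∈ map (x ∷_) (modifyEach g xs) → g x ∷ xs ≢ z
    firstDiffers z∈ eq with ∈-map⁻ (x ∷_) z∈
    ... | _ , _ , refl = moves x (ListP.∷-injectiveˡ eq)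

  picks-AllPairs : {R : A → A → Set ℓ} {xs : List A} {y : A} {r : List A} →
                   AllPairs R xs → (y , r) ∈ picks xs → AllPairs R r
  picks-AllPairs {xs = x ∷ xs} (_ ∷ xs-sorted) (here refl) = xs-sorted
  picks-AllPairs {xs = x ∷ xs} (x-first ∷ xs-sorted) (there yr∈) with ∈-map⁻ _ yr∈
  ... | _ , yr∈′ , refl =
    All.tabulate (λ z∈ → All.lookup x-first (PermP.∈-resp-↭ (↭-sym (picks-↭ yr∈′)) (there z∈)))
    ∷ picks-AllPairs xs-sorted yr∈′

  AllPairs-pointwise : {R S : A → A → Set ℓ} → (∀ {x x′ y y′} → S x x′ → S y y′ → R x y → R x′ y′) →
    {xs ys : List A} → Pointwise S xs ys → AllPairs R xs → AllPairs R ys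
  AllPairs-pointwise preserves [] [] = []
  AllPairs-pointwise {R = R} preserves (x∼y ∷ xs∼ys) (x-first ∷ xs-sorted) =
    first xs∼ys x-first ∷ AllPairs-pointwise preserves xs∼ys xs-sorted
    where
    first : ∀ {xs ys} → Pointwise _ xs ys → All (R _) xs → All (R _) ys
    first [] [] = []
    first (u∼v ∷ us∼vs) (p ∷ ps) = preserves x∼y u∼v p ∷ first us∼vs ps

  module _ {m : ℕ} where

    private Block = List (Fin m)

    <head-trans : {x y z : Block} → x <head y → y <head z → x <head z
    <head-trans {_ ∷ _} {_ ∷ _} {_ ∷ _} = ℕP.<-trans

    <head-asym : {x y : Block} → x <head y → ¬ (y <head x)
    <head-asym {_ ∷ _} {_ ∷ _} = ℕP.<-asym

    <head-compare : (x y : Block) → NonEmpty x → NonEmpty y → head x ≢ head y →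
                    x <head y ⊎ y <head x
    <head-compare (i ∷ _) (j ∷ _) _ _ i≢j with ℕP.<-cmp (toℕ i) (toℕ j)
    ... | tri< i<j _ _ = inj₁ i<j
    ... | tri≈ _ i≡j _ = ⊥-elim (i≢j (cong just (FinP.toℕ-injective i≡j)))
    ... | tri> _ _ j<i = inj₂ j<i

    Linked⇒sorted : {xs : List Block} → Linked _<head_ xs → AllPairs _<head_ xs
    Linked⇒sorted = LinkedP.Linked⇒AllPairs <head-trans

    sorted-↭⇒≡ : {xs ys : List Block} → AllPairs _<head_ xs → AllPairs _<head_ ys → xs ↭ ys → xs ≡ ys
    sorted-↭⇒≡ {[]} {[]} _ _ _ = refl
    sorted-↭⇒≡ {[]} {_ ∷ _} _ _ p with PermP.↭-length p
    ... | ()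
    sorted-↭⇒≡ {_ ∷ _} {[]} _ _ p with PermP.↭-length p
    ... | ()
    sorted-↭⇒≡ {x ∷ xs} {y ∷ ys} (x-first ∷ xs-sorted) (y-first ∷ ys-sorted) p
      with ListP.≡-dec _≟_ x y
    ... | yes refl = cong (x ∷_) (sorted-↭⇒≡ xs-sorted ys-sorted (PermP.drop-∷ p))
    ... | no x≢y = ⊥-elim (<head-asym (All.lookup x-first y∈xs) (All.lookup y-first x∈ys))
      where
      x∈ys : x ∈ ys
      x∈ys with PermP.∈-resp-↭ p (here refl)
      ... | here x≡y = ⊥-elim (x≢y x≡y)
      ... | there x∈ = x∈
      y∈xs : y ∈ xs
      y∈xs with PermP.∈-resp-↭ (↭-sym p) (here refl)
      ... | here y≡x = ⊥-elim (x≢y (sym y≡x))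
      ... | there y∈ = y∈

    insertBlock : Block → List Block → List Block
    insertBlock x [] = [ x ]
    insertBlock x (y ∷ ys) with x <head? y
    ... | yes _ = x ∷ y ∷ ys
    ... | no _ = y ∷ insertBlock x ys

    insertBlock-↭ : (x : Block) (ys : List Block) → insertBlock x ys ↭ x ∷ ys
    insertBlock-↭ x [] = ↭-refl
    insertBlock-↭ x (y ∷ ys) with x <head? y
    ... | yes _ = ↭-refl
    ... | no _ = ↭-trans (prep y (insertBlock-↭ x ys)) (swap y x ↭-refl)

    sortBlocks : List Block → List Block
    sortBlocks [] = []
    sortBlocks (x ∷ xs) = insertBlock x (sortBlocks xs)

    sortBlocks-↭ : (xs : List Block) → sortBlocks xs ↭ xs
    sortBlocks-↭ [] = ↭-refl
    sortBlocks-↭ (x ∷ xs) = ↭-trans (insertBlock-↭ x (sortBlocks xs)) (prep x (sortBlocks-↭ xs))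

    insertBlock-sorted : (x : Block) (ys : List Block) → AllPairs _<head_ ys →
      All (λ y → x <head y ⊎ y <head x) ys → AllPairs _<head_ (insertBlock x ys)
    insertBlock-sorted x [] _ _ = [] ∷ []
    insertBlock-sorted x (y ∷ ys) (y-first ∷ ys-sorted) (x∼y ∷ x∼ys) with x <head? y
    ... | yes x<y = (x<y ∷ All.map (<head-trans x<y) y-first) ∷ y-first ∷ ys-sorted
    ... | no x≮y with x∼y
    ...   | inj₁ x<y = ⊥-elim (x≮y x<y)
    ...   | inj₂ y<x = PermP.All-resp-↭ (↭-sym (insertBlock-↭ x ys)) (y<x ∷ y-first)
                       ∷ insertBlock-sorted x ys ys-sorted x∼ys

    distinctHeads : (x : Block) (xs : List Block) {y : Block} → NonEmpty x →
                    Unique (x ++ concat xs) → y ∈ xs → head x ≢ head y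
    distinctHeads (i ∷ x) xs {[]} _ u y∈ ()
    distinctHeads (i ∷ x) xs {j ∷ y} _ u y∈ hx≡hy with just-injective hx≡hy
    ... | refl = unique-++-disjoint (i ∷ x) u (here refl) (∈-concat⁺′ (here refl) y∈)

    -- blocks of a set partition have distinct first elements, so sorting
    -- them by first elements succeeds
    sortBlocks-sorted : (xs : List Block) → All NonEmpty xs → Unique (concat xs) →
                        AllPairs _<head_ (sortBlocks xs)
    sortBlocks-sorted [] _ _ = []
    sortBlocks-sorted (x ∷ xs) (x-ne ∷ xs-ne) u =
      insertBlock-sorted x (sortBlocks xs) (sortBlocks-sorted xs xs-ne (unique-++ʳ x u))
        (PermP.All-resp-↭ (↭-sym (sortBlocks-↭ xs)) (All.tabulate comparable))
      where
      comparable : ∀ {y} → y ∈ xs → x <head y ⊎ y <head x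
      comparable {y} y∈ = <head-compare x y x-ne (All.lookup xs-ne y∈) (distinctHeads x xs x-ne u y∈)

  module _ {n : ℕ} where

    private Block = List (Fin (suc n))

    ProperBlock : Block → Set
    ProperBlock b = Positive b × NonEmpty b

    relabelBlocks : List (List (Fin n)) → List Block
    relabelBlocks = map relabel

    record Relabelled (sP : List Block) : Set where
      field
        proper : All ProperBlock sP
        sorted : AllPairs _<head_ sP
        disjoint : Unique (concat sP)
        covers : ∀ (i : Fin n) → Fin.suc i ∈ concat sP
    open Relabelled

    prependZero : List Block → List (List Block)
    prependZero sP = map (λ (b , r) → (Fin.zero ∷ b) ∷ r) (picks sP)

    appendZero : List Block → List (List Block)
    appendZero sP = modifyEach (_++ [ Fin.zero ]) sP

    joinAtZero : List Block → List (List Block)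
    joinAtZero sP = concatMap (λ (y , r) → modifyEach (_++ Fin.zero ∷ y) r) (picks sP)

    insertZero : List Block → List (List Block)
    insertZero sP = ([ Fin.zero ] ∷ sP) ∷ (prependZero sP ++ (appendZero sP ++ joinAtZero sP))

    -- head-preserving relation between blocks (used to transport sortedness)
    SameHead : Block → Block → Set
    SameHead b b′ = NonEmpty b → head b ≡ head b′

    <head-SameHead : ∀ {b b′ c c′} → SameHead b b′ → SameHead c c′ → b <head c → b′ <head c′
    <head-SameHead {_ ∷ _} {_ ∷ _} {_ ∷ _} {_ ∷ _} b∼b′ c∼c′ b<c with b∼b′ tt | c∼c′ tt
    ... | refl | refl = b<c
    <head-SameHead {_ ∷ _} {[]} {_ ∷ _} b∼b′ _ _ with b∼b′ tt
    ... | ()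
    <head-SameHead {_ ∷ _} {_ ∷ _} {_ ∷ _} {[]} _ c∼c′ _ with c∼c′ tt
    ... | ()

    SameHead-++ : (w b : Block) → SameHead b (b ++ w)
    SameHead-++ w (_ ∷ _) _ = refl

    data Insertion (sP z : List Block) : Set where
      singleton : z ≡ [ Fin.zero ] ∷ sP → Insertion sP z
      prepend : ∀ b r → (b , r) ∈ picks sP → z ≡ (Fin.zero ∷ b) ∷ r → Insertion sP z
      append : ∀ x r → (x , r) ∈ picks sP → z ↭ (x ++ [ Fin.zero ]) ∷ r →
               Pointwise SameHead sP z → Insertion sP z
      join : ∀ y r x r′ → (y , r) ∈ picks sP → (x , r′) ∈ picks r → z ↭ (x ++ Fin.zero ∷ y) ∷ r′ →
             Pointwise SameHead r z → Insertion sP z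

    insertion-shape : (sP : List Block) {z : List Block} → z ∈ insertZero sP → Insertion sP z
    insertion-shape sP (here refl) = singleton refl
    insertion-shape sP (there z∈) with ∈-++⁻ (prependZero sP) z∈
    ... | inj₁ z∈P with ∈-map⁻ _ z∈P
    ...   | (b , r) , br∈ , refl = prepend b r br∈ refl
    insertion-shape sP (there z∈) | inj₂ z∈′ with ∈-++⁻ (appendZero sP) z∈′
    ... | inj₁ z∈A with modifyEach-↭ (_++ [ Fin.zero ]) z∈A
    ...   | x , r , xr∈ , z↭ =
      append x r xr∈ z↭ (modifyEach-pointwise _ (λ _ _ → refl) (SameHead-++ _) z∈A)
    insertion-shape sP (there z∈) | inj₂ z∈′ | inj₂ z∈J
      with ∈-concatMap-elim (λ (y , r) → modifyEach (_++ Fin.zero ∷ y) r) (picks sP) z∈J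
    ... | (y , r) , yr∈ , z∈M with modifyEach-↭ (_++ Fin.zero ∷ y) z∈M
    ...   | x , r′ , xr′∈ , z↭ =
      join y r x r′ yr∈ xr′∈ z↭ (modifyEach-pointwise _ (λ _ _ → refl) (SameHead-++ _) z∈M)

    picked : {P : Block → Set} {xs : List Block} {y : Block} {r : List Block} →
             (y , r) ∈ picks xs → All P xs → All P (y ∷ r)
    picked yr∈ = PermP.All-resp-↭ (picks-↭ yr∈)

    zero-first : (b c : Block) → ProperBlock c → (Fin.zero ∷ b) <head c
    zero-first b (Fin.zero ∷ _) ((() ∷ _) , _)
    zero-first b (Fin.suc _ ∷ _) _ = s≤s z≤n

    zero∉ : {sP : List Block} → All ProperBlock sP → Fin.zero ∉ concat sP
    zero∉ {b ∷ sP} ((b-pos , _) ∷ sP-proper) 0∈ with ∈-++⁻ b 0∈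
    ... | inj₁ 0∈b with All.lookup b-pos 0∈b
    ...   | ()
    zero∉ {b ∷ sP} (_ ∷ sP-proper) 0∈ | inj₂ 0∈sP = zero∉ sP-proper 0∈sP

    insertion-nonempty : {sP z : List Block} → Relabelled sP → Insertion sP z → All NonEmpty z
    insertion-nonempty rel (singleton refl) = tt ∷ All.map proj₂ (proper rel)
    insertion-nonempty rel (prepend b r br∈ refl) with picked br∈ (proper rel)
    ... | _ ∷ r-proper = tt ∷ All.map proj₂ r-proper
    insertion-nonempty rel (append x r xr∈ z↭ _) with picked xr∈ (proper rel)
    ... | (_ , x-ne) ∷ r-proper = PermP.All-resp-↭ (↭-sym z↭) (ne x x-ne ∷ All.map proj₂ r-proper)
      where ne : ∀ x → NonEmpty x → NonEmpty (x ++ [ Fin.zero ])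
            ne (_ ∷ _) _ = tt
    insertion-nonempty rel (join y r x r′ yr∈ xr′∈ z↭ _) with picked yr∈ (proper rel)
    ... | _ ∷ r-proper with picked xr′∈ r-proper
    ...   | (_ , x-ne) ∷ r′-proper = PermP.All-resp-↭ (↭-sym z↭) (ne x x-ne ∷ All.map proj₂ r′-proper)
      where ne : ∀ x → NonEmpty x → NonEmpty (x ++ Fin.zero ∷ y)
            ne (_ ∷ _) _ = tt

    insertion-elements : {sP z : List Block} → Insertion sP z → concat z ↭ Fin.zero ∷ concat sP
    insertion-elements (singleton refl) = ↭-refl
    insertion-elements (prepend b r br∈ refl) = prep Fin.zero (concat-↭ (↭-sym (picks-↭ br∈)))
    insertion-elements {sP} {z} (append x r xr∈ z↭ _) = begin
      concat z                                ↭⟨ concat-↭ z↭ ⟩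
      (x ++ [ Fin.zero ]) ++ concat r         ≡⟨ ListP.++-assoc x [ Fin.zero ] (concat r) ⟩
      x ++ Fin.zero ∷ concat r                ↭⟨ PermP.shift Fin.zero x (concat r) ⟩
      Fin.zero ∷ concat (x ∷ r)               ↭⟨ prep Fin.zero (concat-↭ (↭-sym (picks-↭ xr∈))) ⟩
      Fin.zero ∷ concat sP                    ∎
      where open Perm.PermutationReasoning
    insertion-elements {sP} {z} (join y r x r′ yr∈ xr′∈ z↭ _) = begin
      concat z                                ↭⟨ concat-↭ z↭ ⟩
      (x ++ Fin.zero ∷ y) ++ concat r′        ≡⟨ ListP.++-assoc x (Fin.zero ∷ y) (concat r′) ⟩
      x ++ Fin.zero ∷ (y ++ concat r′)        ↭⟨ PermP.shift Fin.zero x (y ++ concat r′) ⟩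
      Fin.zero ∷ (x ++ y ++ concat r′)        ↭⟨ prep Fin.zero (PermP.shifts x y) ⟩
      Fin.zero ∷ (y ++ x ++ concat r′)
        ↭⟨ prep Fin.zero (PermP.++⁺ˡ y (concat-↭ (↭-sym (picks-↭ xr′∈)))) ⟩
      Fin.zero ∷ (y ++ concat r)              ↭⟨ prep Fin.zero (concat-↭ (↭-sym (picks-↭ yr∈))) ⟩
      Fin.zero ∷ concat sP                    ∎
      where open Perm.PermutationReasoning

    -- a new first block starting with 0 comes first; appending or joining
    -- keeps the first elements of the surviving blocks
    insertion-sorted : {sP z : List Block} → Relabelled sP → Insertion sP z → AllPairs _<head_ z
    insertion-sorted rel (singleton refl) = All.map (zero-first [] _) (proper rel) ∷ sorted rel
    insertion-sorted rel (prepend b r br∈ refl) with picked br∈ (proper rel)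
    ... | _ ∷ r-proper = All.map (zero-first b _) r-proper ∷ picks-AllPairs (sorted rel) br∈
    insertion-sorted rel (append _ _ _ _ sameHeads) =
      AllPairs-pointwise <head-SameHead sameHeads (sorted rel)
    insertion-sorted rel (join _ _ _ _ yr∈ _ _ sameHeads) =
      AllPairs-pointwise <head-SameHead sameHeads (picks-AllPairs (sorted rel) yr∈)

    insertion-valid : {sP z : List Block} → Relabelled sP → z ∈ insertZero sP → IsListPartition z
    insertion-valid {sP} {z} rel z∈ =
      insertion-nonempty rel shape , z-disjoint , z-covers ,
      LinkedP.AllPairs⇒Linked (insertion-sorted rel shape)
      where
      shape = insertion-shape sP z∈
      z-disjoint : Unique (concat z)
      z-disjoint = Unique-resp-↭ (↭-sym (insertion-elements shape))
        (All.tabulate (λ i∈ 0≡i → zero∉ (proper rel) (subst (_∈ concat sP) (sym 0≡i) i∈)) ∷ disjoint rel)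
      z-covers : ∀ i → i ∈ concat z
      z-covers Fin.zero = PermP.∈-resp-↭ (↭-sym (insertion-elements shape)) (here refl)
      z-covers (Fin.suc i) = PermP.∈-resp-↭ (↭-sym (insertion-elements shape)) (there (covers rel i))

    relabelled : {P : List (List (Fin n))} → IsListPartition P → Relabelled (relabelBlocks P)
    relabelled {P} (P-ne , P-disjoint , P-covers , P-linked) = record
      { proper = proper′ P P-ne
      ; sorted = AllPairsP.map⁺ (AllPairs.map relabel-<head (Linked⇒sorted P-linked))
      ; disjoint = subst Unique (sym (ListP.concat-map P)) (UniqueP.map⁺ FinP.suc-injective P-disjoint)
      ; covers = λ i → subst (Fin.suc i ∈_) (sym (ListP.concat-map P)) (∈-map⁺ Fin.suc (P-covers i))
      }
      where
      proper′ : ∀ P → All NonEmpty P → All ProperBlock (relabelBlocks P)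
      proper′ [] [] = []
      proper′ ((_ ∷ b) ∷ P) (_ ∷ P-ne) = (AllP.map⁺ (All.tabulate (λ _ → s≤s z≤n)) , tt) ∷ proper′ P P-ne
      relabel-<head : ∀ {b c} → b <head c → relabel b <head relabel c
      relabel-<head {_ ∷ _} {_ ∷ _} = s≤s

    unrelabelled : {sP : List Block} → Relabelled sP →
                   IsListPartition (map unrelabel sP) × relabelBlocks (map unrelabel sP) ≡ sP
    unrelabelled {sP} rel = (P-ne , P-disjoint , P-covers , P-linked) , P≡
      where
      P = map unrelabel sP
      P≡ : relabelBlocks P ≡ sP
      P≡ = trans (sym (ListP.map-∘ sP))
             (ListP.map-id-local (All.map (λ (b-pos , _) → relabel-unrelabel _ b-pos) (proper rel)))
      elements : map Fin.suc (concat P) ≡ concat sP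
      elements = trans (sym (ListP.concat-map P)) (cong concat P≡)
      P-ne : All NonEmpty P
      P-ne = AllP.map⁺ (All.map ne (proper rel))
        where ne : ∀ {b} → ProperBlock b → NonEmpty (unrelabel b)
              ne {Fin.zero ∷ _} ((() ∷ _) , _)
              ne {Fin.suc _ ∷ _} _ = tt
      P-disjoint : Unique (concat P)
      P-disjoint = UniqueP.map⁻ (subst Unique (sym elements) (disjoint rel))
      P-covers : ∀ i → i ∈ concat P
      P-covers i with ∈-map⁻ Fin.suc (subst (Fin.suc i ∈_) (sym elements) (covers rel i))
      ... | j , j∈ , i≡j = subst (_∈ concat P) (sym (FinP.suc-injective i≡j)) j∈
      unrelabel-<head : ∀ {b c} → relabel b <head relabel c → b <head c
      unrelabel-<head {_ ∷ _} {_ ∷ _} (s≤s b<c) = b<c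
      P-linked : Linked _<head_ P
      P-linked = LinkedP.AllPairs⇒Linked (AllPairs.map unrelabel-<head
        (AllPairsP.map⁻ (subst (AllPairs _<head_) (sym P≡) (sorted rel))))

    splitAtZero : Block → Block × Block
    splitAtZero [] = [] , []
    splitAtZero (Fin.zero ∷ b) = [] , b
    splitAtZero (Fin.suc i ∷ b) = Fin.suc i ∷ proj₁ (splitAtZero b) , proj₂ (splitAtZero b)

    nonemptyBlock : Block → List Block
    nonemptyBlock [] = []
    nonemptyBlock b@(_ ∷ _) = [ b ]

    deleteZeroBlock : Block → List Block
    deleteZeroBlock b = nonemptyBlock (proj₁ (splitAtZero b)) ++ nonemptyBlock (proj₂ (splitAtZero b))

    deleteZero : List Block → List Block
    deleteZero = concatMap deleteZeroBlock

    splitAtZero-positive : (b : Block) → Positive b → splitAtZero b ≡ (b , [])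
    splitAtZero-positive [] _ = refl
    splitAtZero-positive (Fin.suc i ∷ b) (_ ∷ b-pos) rewrite splitAtZero-positive b b-pos = refl

    splitAtZero-join : (x y : Block) → Positive x → splitAtZero (x ++ Fin.zero ∷ y) ≡ (x , y)
    splitAtZero-join [] y _ = refl
    splitAtZero-join (Fin.suc i ∷ x) y (_ ∷ x-pos) rewrite splitAtZero-join x y x-pos = refl

    deleteZeroBlock-join : (x y : Block) → Positive x →
                           deleteZeroBlock (x ++ Fin.zero ∷ y) ≡ nonemptyBlock x ++ nonemptyBlock y
    deleteZeroBlock-join x y x-pos rewrite splitAtZero-join x y x-pos = refl

    deleteZero-proper : (l : List Block) → All ProperBlock l → deleteZero l ≡ l
    deleteZero-proper [] [] = refl
    deleteZero-proper ((i ∷ b) ∷ l) ((b-pos , _) ∷ l-proper)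
      rewrite splitAtZero-positive (i ∷ b) b-pos = cong ((i ∷ b) ∷_) (deleteZero-proper l l-proper)

    deleteZero-↭ : {z z′ : List Block} → z ↭ z′ → deleteZero z ↭ deleteZero z′
    deleteZero-↭ p = concat-↭ (PermP.map⁺ deleteZeroBlock p)

    deleteZero-insertion : {sP z : List Block} → Relabelled sP → Insertion sP z → deleteZero z ↭ sP
    deleteZero-insertion rel (singleton refl) = Perm.↭-reflexive (deleteZero-proper _ (proper rel))
    deleteZero-insertion rel (prepend [] r br∈ refl) with picked br∈ (proper rel)
    ... | (_ , ()) ∷ _
    deleteZero-insertion rel (prepend b@(_ ∷ _) r br∈ refl) with picked br∈ (proper rel)
    ... | _ ∷ r-proper =
      ↭-trans (Perm.↭-reflexive (cong (b ∷_) (deleteZero-proper r r-proper))) (↭-sym (picks-↭ br∈))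
    deleteZero-insertion {sP} {z} rel (append x r xr∈ z↭ _) with picked xr∈ (proper rel)
    ... | (x-pos , x-ne) ∷ r-proper = begin
      deleteZero z                                       ↭⟨ deleteZero-↭ z↭ ⟩
      deleteZeroBlock (x ++ [ Fin.zero ]) ++ deleteZero r
        ≡⟨ cong₂ _++_ (deleteZeroBlock-join x [] x-pos) (deleteZero-proper r r-proper) ⟩
      (nonemptyBlock x ++ []) ++ r                       ≡⟨ cong (_++ r) (single x x-ne) ⟩
      x ∷ r                                              ↭⟨ ↭-sym (picks-↭ xr∈) ⟩
      sP                                                 ∎
      where
      open Perm.PermutationReasoning
      single : ∀ x → NonEmpty x → nonemptyBlock x ++ [] ≡ [ x ]
      single (_ ∷ _) _ = refl
    deleteZero-insertion {sP} {z} rel (join y r x r′ yr∈ xr′∈ z↭ _) with picked yr∈ (proper rel)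
    ... | (_ , y-ne) ∷ r-proper with picked xr′∈ r-proper
    ...   | (x-pos , x-ne) ∷ r′-proper = begin
      deleteZero z                                       ↭⟨ deleteZero-↭ z↭ ⟩
      deleteZeroBlock (x ++ Fin.zero ∷ y) ++ deleteZero r′
        ≡⟨ cong₂ _++_ (deleteZeroBlock-join x y x-pos) (deleteZero-proper r′ r′-proper) ⟩
      (nonemptyBlock x ++ nonemptyBlock y) ++ r′         ≡⟨ cong (_++ r′) (pair x y x-ne y-ne) ⟩
      x ∷ y ∷ r′                                         ↭⟨ swap x y ↭-refl ⟩
      y ∷ x ∷ r′                                         ↭⟨ prep y (↭-sym (picks-↭ xr′∈)) ⟩
      y ∷ r                                              ↭⟨ ↭-sym (picks-↭ yr∈) ⟩
      sP                                                 ∎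
      where
      open Perm.PermutationReasoning
      pair : ∀ x y → NonEmpty x → NonEmpty y → nonemptyBlock x ++ nonemptyBlock y ≡ x ∷ y ∷ []
      pair (_ ∷ _) (_ ∷ _) _ _ = refl

    removeZero : List Block → List (List (Fin n))
    removeZero z = map unrelabel (sortBlocks (deleteZero z))

    removeZero-insertion : {P : List (List (Fin n))} {z : List Block} → IsListPartition P →
                           z ∈ insertZero (relabelBlocks P) → removeZero z ≡ P
    removeZero-insertion {P} {z} P-part z∈ =
      trans (cong (map unrelabel) sorted≡)
        (trans (sym (ListP.map-∘ P)) (trans (ListP.map-cong unrelabel-relabel P) (ListP.map-id P)))
      where
      rel : Relabelled (relabelBlocks P)
      rel = relabelled P-part
      deleted↭ : deleteZero z ↭ relabelBlocks P
      deleted↭ = deleteZero-insertion rel (insertion-shape _ z∈)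
      deleted-proper : All ProperBlock (deleteZero z)
      deleted-proper = PermP.All-resp-↭ (↭-sym deleted↭) (proper rel)
      sorted≡ : sortBlocks (deleteZero z) ≡ relabelBlocks P
      sorted≡ = sorted-↭⇒≡
        (sortBlocks-sorted _ (All.map proj₂ deleted-proper)
          (Unique-resp-↭ (concat-↭ (↭-sym deleted↭)) (disjoint rel)))
        (sorted rel) (↭-trans (sortBlocks-↭ _) deleted↭)

    ∉⇒Positive : (b : Block) → Fin.zero ∉ b → Positive b
    ∉⇒Positive b 0∉b = All.tabulate λ {w} w∈b → positive w w∈b
      where
      positive : ∀ w → w ∈ b → 0 < toℕ w
      positive Fin.zero w∈b = ⊥-elim (0∉b w∈b)
      positive (Fin.suc _) _ = s≤s z≤n

    nonemptyBlock-nonempty : (x : Block) → All NonEmpty (nonemptyBlock x)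
    nonemptyBlock-nonempty [] = []
    nonemptyBlock-nonempty (_ ∷ _) = tt ∷ []

    concat-nonemptyBlock : (x : Block) → concat (nonemptyBlock x) ≡ x
    concat-nonemptyBlock [] = refl
    concat-nonemptyBlock (i ∷ x) = ListP.++-identityʳ (i ∷ x)

    module _ (Q : List Block) (x y : Block) where

      private
        split = (nonemptyBlock x ++ nonemptyBlock y) ++ Q

      split-elements : concat split ≡ x ++ y ++ concat Q
      split-elements =
        trans (sym (ListP.concat-++ (nonemptyBlock x ++ nonemptyBlock y) Q))
          (trans (cong (_++ concat Q)
                   (trans (sym (ListP.concat-++ (nonemptyBlock x) (nonemptyBlock y)))
                          (cong₂ _++_ (concat-nonemptyBlock x) (concat-nonemptyBlock y))))
                 (ListP.++-assoc x y (concat Q)))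

      joined-elements : concat ((x ++ Fin.zero ∷ y) ∷ Q) ↭ Fin.zero ∷ concat split
      joined-elements = begin
        (x ++ Fin.zero ∷ y) ++ concat Q ≡⟨ ListP.++-assoc x (Fin.zero ∷ y) (concat Q) ⟩
        x ++ Fin.zero ∷ (y ++ concat Q) ↭⟨ PermP.shift Fin.zero x (y ++ concat Q) ⟩
        Fin.zero ∷ x ++ y ++ concat Q   ≡⟨ cong (Fin.zero ∷_) (sym split-elements) ⟩
        Fin.zero ∷ concat split         ∎
        where open Perm.PermutationReasoning

      split-relabelled : {z : List Block} → IsListPartition z → z ↭ (x ++ Fin.zero ∷ y) ∷ Q →
                         Relabelled (sortBlocks split)
      split-relabelled (z-ne , z-disjoint , z-covers , _) z↭ with
        Unique-resp-↭ (↭-trans (concat-↭ z↭) joined-elements) z-disjoint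
      ... | 0∉split ∷ split-disjoint = record
        { proper = PermP.All-resp-↭ (↭-sym (sortBlocks-↭ split)) split-proper
        ; sorted = sortBlocks-sorted split (All.map proj₂ split-proper) split-disjoint
        ; disjoint = Unique-resp-↭ (concat-↭ (↭-sym (sortBlocks-↭ split))) split-disjoint
        ; covers = λ i → PermP.∈-resp-↭ (concat-↭ (↭-sym (sortBlocks-↭ split))) (covers′ i)
        }
        where
        avoids0 : All (λ b → Fin.zero ∉ b) split
        avoids0 = All.tabulate λ b∈ 0∈b → All.lookup 0∉split (∈-concat⁺′ 0∈b b∈) refl
        split-ne : All NonEmpty split
        split-ne with PermP.All-resp-↭ z↭ z-ne
        ... | _ ∷ Q-ne = AllP.++⁺ (AllP.++⁺ (nonemptyBlock-nonempty x) (nonemptyBlock-nonempty y)) Q-ne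
        split-proper : All ProperBlock split
        split-proper = All.zipWith (λ (0∉b , b-ne) → ∉⇒Positive _ 0∉b , b-ne) (avoids0 , split-ne)
        covers′ : ∀ i → Fin.suc i ∈ concat split
        covers′ i with PermP.∈-resp-↭ (↭-trans (concat-↭ z↭) joined-elements) (z-covers (Fin.suc i))
        ... | there i∈ = i∈

    insertZero-join : (sP Q : List Block) (x y : Block) → sP ↭ (nonemptyBlock x ++ nonemptyBlock y) ++ Q →
                      ∃ λ z → z ∈ insertZero sP × z ↭ (x ++ Fin.zero ∷ y) ∷ Q
    insertZero-join sP Q [] [] sP↭ = _ , here refl , prep _ sP↭
    insertZero-join sP Q [] y@(_ ∷ _) sP↭ with picks-complete (PermP.∈-resp-↭ (↭-sym sP↭) (here refl))
    ... | r , yr∈ = _ , there (∈-++⁺ˡ (∈-map⁺ _ yr∈)) ,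
                    prep _ (PermP.drop-∷ (↭-trans (↭-sym (picks-↭ yr∈)) sP↭))
    insertZero-join sP Q x@(_ ∷ _) [] sP↭ with picks-complete (PermP.∈-resp-↭ (↭-sym sP↭) (here refl))
    ... | r , xr∈ with modifyEach-complete (_++ [ Fin.zero ]) xr∈
    ...   | z , z∈ , z↭ = z , there (∈-++⁺ʳ (prependZero sP) (∈-++⁺ˡ z∈)) ,
                          ↭-trans z↭ (prep _ (PermP.drop-∷ (↭-trans (↭-sym (picks-↭ xr∈)) sP↭)))
    insertZero-join sP Q x@(_ ∷ _) y@(_ ∷ _) sP↭
      with picks-complete (PermP.∈-resp-↭ (↭-sym sP↭) (there (here refl)))
    ... | r , yr∈ with PermP.drop-∷ (↭-trans (↭-sym (picks-↭ yr∈)) (↭-trans sP↭ (swap x y ↭-refl)))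
    ...   | r↭ with picks-complete (PermP.∈-resp-↭ (↭-sym r↭) (here refl))
    ...     | r′ , xr′∈ with modifyEach-complete (_++ Fin.zero ∷ y) xr′∈
    ...       | z , z∈ , z↭ =
      z , there (∈-++⁺ʳ (prependZero sP) (∈-++⁺ʳ (appendZero sP)
            (∈-concatMap-intro (λ (y , r) → modifyEach (_++ Fin.zero ∷ y) r) yr∈ z∈))) ,
      ↭-trans z↭ (prep _ (PermP.drop-∷ (↭-trans (↭-sym (picks-↭ xr′∈)) r↭)))

    -- Locate the block x ++ 0 ∷ y of z; then z is the insertion of 0 joining
    -- x and y in the partition obtained by deleting 0.
    insertion-complete : {z : List Block} → IsListPartition z →
                         ∃ λ P → IsListPartition P × z ∈ insertZero (relabelBlocks P)
    insertion-complete {z} z-part@(_ , _ , z-covers , z-linked)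
      with ∈-concat⁻′ z (z-covers Fin.zero)
    ... | b , 0∈b , b∈z with ∈-∃++ 0∈b
    ... | x , y , refl with ∈-∃++ b∈z
    ... | pre , post , refl = P , P-part , subst (λ sP → z ∈ insertZero sP) (sym P≡) z∈
      where
      Q = pre ++ post
      z↭ : z ↭ (x ++ Fin.zero ∷ y) ∷ Q
      z↭ = PermP.shift _ pre post
      sP = sortBlocks ((nonemptyBlock x ++ nonemptyBlock y) ++ Q)
      rel : Relabelled sP
      rel = split-relabelled Q x y z-part z↭
      P = map unrelabel sP
      P-part = proj₁ (unrelabelled rel)
      P≡ = proj₂ (unrelabelled rel)
      z∈ : z ∈ insertZero sP
      z∈ with insertZero-join sP Q x y (sortBlocks-↭ _)
      ... | z′ , z′∈ , z′↭ = subst (_∈ insertZero sP) z′≡z z′∈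
        where
        z′≡z : z′ ≡ z
        z′≡z = sorted-↭⇒≡ (insertion-sorted rel (insertion-shape sP z′∈)) (Linked⇒sorted z-linked)
                 (↭-trans z′↭ (↭-sym z↭))

    -- The insertions of 0 into a relabelled partition are pairwise distinct:
    -- they are told apart by the parts before and after 0 in its block.

    open MemDec (_≟_ {suc n}) using (_∈?_)

    zeroBlock : List Block → Block
    zeroBlock [] = []
    zeroBlock (b ∷ z) with Fin.zero ∈? b
    ... | yes _ = b
    ... | no _ = zeroBlock z

    zeroBlock-here : (b : Block) (z : List Block) → Fin.zero ∈ b → zeroBlock (b ∷ z) ≡ b
    zeroBlock-here b z 0∈b with Fin.zero ∈? b
    ... | yes _ = refl
    ... | no 0∉b = ⊥-elim (0∉b 0∈b)

    zeroBlock-there : (b : Block) (z : List Block) → Positive b → zeroBlock (b ∷ z) ≡ zeroBlock z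
    zeroBlock-there b z b-pos with Fin.zero ∈? b
    ... | yes 0∈b with All.lookup b-pos 0∈b
    ...   | ()
    zeroBlock-there b z b-pos | no _ = refl

    zeroBlock-modified : (w : Block) {xs : List Block} {z : List Block} → All ProperBlock xs →
      z ∈ modifyEach (_++ Fin.zero ∷ w) xs → ∃ λ x → ProperBlock x × zeroBlock z ≡ x ++ Fin.zero ∷ w
    zeroBlock-modified w {x ∷ xs} (x-proper ∷ _) (here refl) =
      x , x-proper , zeroBlock-here _ xs (∈-++⁺ʳ x (here refl))
    zeroBlock-modified w {x ∷ xs} ((x-pos , _) ∷ xs-proper) (there z∈) with ∈-map⁻ (x ∷_) z∈
    ... | z′ , z′∈ , refl with zeroBlock-modified w xs-proper z′∈
    ... | x′ , x′-proper , eq = x′ , x′-proper , trans (zeroBlock-there x z′ x-pos) eq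

    emptinessPattern : Block × Block → ℕ
    emptinessPattern ([] , []) = 0
    emptinessPattern ([] , _ ∷ _) = 1
    emptinessPattern (_ ∷ _ , []) = 2
    emptinessPattern (_ ∷ _ , _ ∷ _) = 3

    -- 0: new singleton, 1: in front of a block, 2: at the end, 3: joining
    kind : List Block → ℕ
    kind z = emptinessPattern (splitAtZero (zeroBlock z))

    blocks-unique : {xs : List Block} → All NonEmpty xs → Unique (concat xs) → Unique xs
    blocks-unique {[]} _ _ = []
    blocks-unique {x ∷ xs} (_ ∷ xs-ne) u = All.tabulate differ ∷ blocks-unique xs-ne (unique-++ʳ x u)
      where
      differ : ∀ {y} → y ∈ xs → x ≢ y
      differ {i ∷ y} y∈ refl = unique-++-disjoint (i ∷ y) u (here refl) (∈-concat⁺′ (here refl) y∈)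

    join-moves : (w x : Block) → x ++ Fin.zero ∷ w ≢ x
    join-moves w x eq = ℕP.m+1+n≢m (length x) (trans (sym (ListP.length-++ x)) (cong length eq))

    module _ {sP : List Block} (rel : Relabelled sP) where

      private
        firsts-unique : Unique (map (λ p → just (proj₁ p)) (picks sP))
        firsts-unique = subst Unique (sym (ListP.map-∘ (picks sP)))
          (UniqueP.map⁺ just-injective (subst Unique (sym (picks-fst sP))
            (blocks-unique (All.map proj₂ (proper rel)) (disjoint rel))))

      kind-singleton : kind ([ Fin.zero ] ∷ sP) ≡ 0
      kind-singleton rewrite zeroBlock-here [ Fin.zero ] sP (here refl) = refl

      kind-prepend : {z : List Block} → z ∈ prependZero sP → kind z ≡ 1
      kind-prepend z∈ with ∈-map⁻ _ z∈
      ... | (b , r) , br∈ , refl with picked br∈ (proper rel)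
      ... | (_ , b-ne) ∷ _ rewrite zeroBlock-here (Fin.zero ∷ b) r (here refl) = shape b b-ne
        where shape : ∀ b → NonEmpty b → emptinessPattern ([] , b) ≡ 1
              shape (_ ∷ _) _ = refl

      kind-append : {z : List Block} → z ∈ appendZero sP → kind z ≡ 2
      kind-append z∈ with zeroBlock-modified [] (proper rel) z∈
      ... | x , (x-pos , x-ne) , eq rewrite eq | splitAtZero-join x [] x-pos = shape x x-ne
        where shape : ∀ x → NonEmpty x → emptinessPattern (x , []) ≡ 2
              shape (_ ∷ _) _ = refl

      kind-join : {z : List Block} → z ∈ joinAtZero sP → kind z ≡ 3
      kind-join z∈ with ∈-concatMap-elim _ (picks sP) z∈
      ... | (y , r) , yr∈ , z∈′ with picked yr∈ (proper rel)
      ... | (_ , y-ne) ∷ r-proper with zeroBlock-modified y r-proper z∈′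
      ... | x , (x-pos , x-ne) , eq rewrite eq | splitAtZero-join x y x-pos = shape x y x-ne y-ne
        where shape : ∀ x y → NonEmpty x → NonEmpty y → emptinessPattern (x , y) ≡ 3
              shape (_ ∷ _) (_ ∷ _) _ _ = refl

      -- within the joins, the block after 0 identifies the picked block y
      joinAtZero-unique : Unique (joinAtZero sP)
      joinAtZero-unique =
        unique-concatMap _ (λ p → just (proj₁ p)) (λ z → just (proj₂ (splitAtZero (zeroBlock z))))
          (picks sP) firsts-unique (λ {p} _ → modifyEach-unique _ (join-moves (proj₁ p)) (proj₂ p)) after0
        where
        after0 : ∀ {p z} → p ∈ picks sP → z ∈ modifyEach (_++ Fin.zero ∷ proj₁ p) (proj₂ p) →
                 just (proj₂ (splitAtZero (zeroBlock z))) ≡ just (proj₁ p)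
        after0 {y , r} yr∈ z∈ with picked yr∈ (proper rel)
        ... | _ ∷ r-proper with zeroBlock-modified y r-proper z∈
        ... | x , (x-pos , _) , eq rewrite eq | splitAtZero-join x y x-pos = refl

      -- insertions of different kinds differ; within a kind, the picked
      -- blocks differ
      insertZero-unique : Unique (insertZero sP)
      insertZero-unique =
        All.tabulate (λ z∈ eq → notSingleton z∈ (trans (cong kind (sym eq)) kind-singleton))
        ∷ UniqueP.++⁺ prepend-unique (UniqueP.++⁺ append-unique joinAtZero-unique disjointAJ) disjointP
        where
        prepend-unique : Unique (prependZero sP)
        prepend-unique = UniqueP.map⁺ (λ { refl → refl }) (UniqueP.map⁻ firsts-unique)
        append-unique : Unique (appendZero sP)
        append-unique = modifyEach-unique _ (join-moves []) sP
        distinct : {k i j : ℕ} → k ≡ i → k ≡ j → i ≢ j → ⊥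
        distinct ki kj i≢j = i≢j (trans (sym ki) kj)
        disjointAJ : ∀ {z} → ¬ (z ∈ appendZero sP × z ∈ joinAtZero sP)
        disjointAJ (z∈A , z∈J) = distinct (kind-append z∈A) (kind-join z∈J) (λ ())
        disjointP : ∀ {z} → ¬ (z ∈ prependZero sP × z ∈ appendZero sP ++ joinAtZero sP)
        disjointP (z∈P , z∈AJ) with ∈-++⁻ (appendZero sP) z∈AJ
        ... | inj₁ z∈A = distinct (kind-prepend z∈P) (kind-append z∈A) (λ ())
        ... | inj₂ z∈J = distinct (kind-prepend z∈P) (kind-join z∈J) (λ ())
        notSingleton : ∀ {z} → z ∈ prependZero sP ++ (appendZero sP ++ joinAtZero sP) → kind z ≢ 0
        notSingleton z∈ with ∈-++⁻ (prependZero sP) z∈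
        ... | inj₁ z∈P = λ k → distinct (kind-prepend z∈P) k (λ ())
        ... | inj₂ z∈AJ with ∈-++⁻ (appendZero sP) z∈AJ
        ...   | inj₁ z∈A = λ k → distinct (kind-append z∈A) k (λ ())
        ...   | inj₂ z∈J = λ k → distinct (kind-join z∈J) k (λ ())

  blocks≤elements : {m : ℕ} {z : List (List (Fin m))} → All NonEmpty z → length z ≤ length (concat z)
  blocks≤elements {z = []} [] = z≤n
  blocks≤elements {z = (_ ∷ b) ∷ z} (_ ∷ z-ne) =
    s≤s (ℕP.≤-trans (blocks≤elements z-ne) (ListP.length-++-≤ʳ (concat z) {b}))

  module _ {m : ℕ} where

    listPartitions-unique : Unique (listPartitions m)
    listPartitions-unique = UniqueP.filter⁺ isListPartition?
      (allLists-unique m (allLists-unique m (UniqueP.allFin⁺ m)))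

    listPartitions-sound : {z : List (List (Fin m))} → z ∈ listPartitions m → IsListPartition z
    listPartitions-sound z∈ =
      proj₂ (∈-filter⁻ isListPartition? {xs = allLists (allLists (allFin m) m) m} z∈)

    listPartitions-complete : {z : List (List (Fin m))} → IsListPartition z → z ∈ listPartitions m
    listPartitions-complete {z} z-part@(z-ne , z-disjoint , _ , _) =
      ∈-filter⁺ isListPartition?
        (allLists-complete m
          (All.tabulate λ b∈ → allLists-complete m (All.tabulate (λ _ → ∈-allFin _))
                                  (unique-length≤ (unique-concat z z-disjoint b∈)))
          (ℕP.≤-trans (blocks≤elements z-ne) (unique-length≤ z-disjoint)))
        z-part

  listPartitions-decomposition : {n : ℕ} →
    listPartitions (suc n) ↭ concatMap (insertZero ∘ relabelBlocks) (listPartitions n)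
  listPartitions-decomposition =
    decomposition-↭ (insertZero ∘ relabelBlocks) removeZero listPartitions-unique listPartitions-unique
      (λ P∈ → insertZero-unique (relabelled (listPartitions-sound P∈)))
      (λ P∈ z∈ → removeZero-insertion (listPartitions-sound P∈) z∈)
      (λ P∈ z∈ → listPartitions-complete (insertion-valid (relabelled (listPartitions-sound P∈)) z∈))
      (λ z∈ → let P , P-part , z∈′ = insertion-complete (listPartitions-sound z∈)
              in P , listPartitions-complete P-part , z∈′)

module InsertionStatistics where

  open import Data.Nat using (suc; _+_; _∸_; _<_; _<?_; s≤s)
  open import Data.Nat.Properties using (+-suc; +-assoc)
  open import Data.Nat.Tactic.RingSolver using (solve-∀)
  import Data.Nat.ListAction as ListAction
  import Data.Nat.ListAction.Properties as ListActionP
  open import Data.Fin as Fin using (Fin; toℕ)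
  open import Data.List using (List; []; _∷_; [_]; _++_; length; map)
  open import Data.List.Relation.Unary.All using (_∷_)
  open import Data.List.Membership.Propositional using (_∈_)
  open import Data.List.Membership.Propositional.Properties using (∈-map⁻)
  open import Data.List.Relation.Binary.Permutation.Propositional using (_↭_)
  import Data.List.Relation.Binary.Permutation.Propositional.Properties as PermP
  open import Data.Product using (_×_; _,_)
  open import Data.Empty using (⊥-elim)
  open import Relation.Nullary using (¬_; yes; no)
  open import Relation.Binary.PropositionalEquality using (_≡_; refl; sym; trans; cong; cong₂; module ≡-Reasoning)
  open ListFacts using (∈-concatMap-elim)
  open Arrangements using (picks; picks-↭; picks-rest-length)
  open Forests using (relabel)
  open ListPartitions

  totalDescents totalAscents : {m : ℕ} → List (List (Fin m)) → ℕ
  totalDescents z = ListAction.sum (map descents z)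
  totalAscents z = ListAction.sum (map ascents z)

  totalDescents-↭ : {m : ℕ} {z z′ : List (List (Fin m))} → z ↭ z′ → totalDescents z ≡ totalDescents z′
  totalDescents-↭ p = ListActionP.sum-↭ (PermP.map⁺ descents p)

  totalAscents-↭ : {m : ℕ} {z z′ : List (List (Fin m))} → z ↭ z′ → totalAscents z ≡ totalAscents z′
  totalAscents-↭ p = ListActionP.sum-↭ (PermP.map⁺ ascents p)

  module _ {m : ℕ} where

    lt01-< : (i j : Fin m) → toℕ i < toℕ j → lt01 i j ≡ 1
    lt01-< i j i<j with toℕ i <? toℕ j
    ... | yes _ = refl
    ... | no i≮j = ⊥-elim (i≮j i<j)

    lt01-≮ : (i j : Fin m) → ¬ (toℕ i < toℕ j) → lt01 i j ≡ 0
    lt01-≮ i j i≮j with toℕ i <? toℕ j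
    ... | yes i<j = ⊥-elim (i≮j i<j)
    ... | no _ = refl

  module _ {n : ℕ} where

    lt01-relabel : (i j : Fin n) → lt01 (Fin.suc i) (Fin.suc j) ≡ lt01 i j
    lt01-relabel i j with toℕ i <? toℕ j
    ... | yes i<j = lt01-< (Fin.suc i) (Fin.suc j) (s≤s i<j)
    ... | no i≮j = lt01-≮ (Fin.suc i) (Fin.suc j) (λ { (s≤s i<j) → i≮j i<j })

    descents-relabel : (b : List (Fin n)) → descents (relabel b) ≡ descents b
    descents-relabel [] = refl
    descents-relabel (_ ∷ []) = refl
    descents-relabel (i ∷ j ∷ b) = cong₂ _+_ (lt01-relabel j i) (descents-relabel (j ∷ b))

    ascents-relabel : (b : List (Fin n)) → ascents (relabel b) ≡ ascents b
    ascents-relabel [] = refl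
    ascents-relabel (_ ∷ []) = refl
    ascents-relabel (i ∷ j ∷ b) = cong₂ _+_ (lt01-relabel i j) (ascents-relabel (j ∷ b))

    totalDescents-relabel : (P : List (List (Fin n))) → totalDescents (relabelBlocks P) ≡ totalDescents P
    totalDescents-relabel [] = refl
    totalDescents-relabel (b ∷ P) = cong₂ _+_ (descents-relabel b) (totalDescents-relabel P)

    totalAscents-relabel : (P : List (List (Fin n))) → totalAscents (relabelBlocks P) ≡ totalAscents P
    totalAscents-relabel [] = refl
    totalAscents-relabel (b ∷ P) = cong₂ _+_ (ascents-relabel b) (totalAscents-relabel P)

    private Block = List (Fin (suc n))

    -- 0 is smaller than every entry of a proper block
    descents-zero∷ : (y : Block) → descents (Fin.zero ∷ y) ≡ descents y
    descents-zero∷ [] = refl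
    descents-zero∷ (j ∷ y) = cong (_+ descents (j ∷ y)) (lt01-≮ j Fin.zero (λ ()))

    ascents-zero∷ : (y : Block) → ProperBlock y → ascents (Fin.zero ∷ y) ≡ suc (ascents y)
    ascents-zero∷ (j ∷ y) ((0<j ∷ _) , _) = cong (_+ ascents (j ∷ y)) (lt01-< Fin.zero j 0<j)

    -- the last entry of x is larger than 0, which is smaller than the first
    -- entry of y
    descents-join : (x y : Block) → ProperBlock x →
                    descents (x ++ Fin.zero ∷ y) ≡ suc (descents x + descents y)
    descents-join (i ∷ []) y ((0<i ∷ _) , _) = cong₂ _+_ (lt01-< Fin.zero i 0<i) (descents-zero∷ y)
    descents-join (i ∷ j ∷ x) y ((_ ∷ x-pos) , _) = begin
      lt01 j i + descents ((j ∷ x) ++ Fin.zero ∷ y) ≡⟨ cong (lt01 j i +_) (descents-join (j ∷ x) y (x-pos , _)) ⟩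
      lt01 j i + suc (descents (j ∷ x) + descents y) ≡⟨ +-suc (lt01 j i) _ ⟩
      suc (lt01 j i + (descents (j ∷ x) + descents y)) ≡⟨ cong suc (sym (+-assoc (lt01 j i) _ _)) ⟩
      suc (descents (i ∷ j ∷ x) + descents y) ∎
      where open ≡-Reasoning

    ascents-join : (x y : Block) → ProperBlock x →
                   ascents (x ++ Fin.zero ∷ y) ≡ ascents x + ascents (Fin.zero ∷ y)
    ascents-join (i ∷ []) y _ = cong (_+ ascents (Fin.zero ∷ y)) (lt01-≮ i Fin.zero (λ ()))
    ascents-join (i ∷ j ∷ x) y ((_ ∷ x-pos) , _) =
      trans (cong (lt01 i j +_) (ascents-join (j ∷ x) y (x-pos , _))) (sym (+-assoc (lt01 i j) _ _))

    Statistics : List Block → ℕ → ℕ → ℕ → Set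
    Statistics z d a t = totalDescents z ≡ d × totalAscents z ≡ a × length z ≡ t

    module _ {sP : List Block} (rel : Relabelled sP) where

      private
        d = totalDescents sP
        a = totalAscents sP

      statistics-prepend : {z : List Block} → z ∈ prependZero sP → Statistics z d (suc a) (length sP)
      statistics-prepend z∈ with ∈-map⁻ _ z∈
      ... | (b , r) , br∈ , refl with picked br∈ (Relabelled.proper rel)
      ... | b-proper ∷ _ =
        trans (cong (_+ totalDescents r) (descents-zero∷ b)) (sym (totalDescents-↭ (picks-↭ br∈))) ,
        trans (cong (_+ totalAscents r) (ascents-zero∷ b b-proper)) (cong suc (sym (totalAscents-↭ (picks-↭ br∈)))) ,
        sym (PermP.↭-length (picks-↭ br∈))

      statistics-append : {z : List Block} → z ∈ appendZero sP → Statistics z (suc d) a (length sP)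
      statistics-append z∈ with modifyEach-↭ (_++ [ Fin.zero ]) z∈
      ... | x , r , xr∈ , z↭ with picked xr∈ (Relabelled.proper rel)
      ... | x-proper ∷ _ =
        trans (totalDescents-↭ z↭)
          (trans (cong (_+ totalDescents r) (descents-join x [] x-proper))
            (trans (arith₁ (descents x) (totalDescents r)) (cong suc (sym (totalDescents-↭ (picks-↭ xr∈)))))) ,
        trans (totalAscents-↭ z↭)
          (trans (cong (_+ totalAscents r) (ascents-join x [] x-proper))
            (trans (arith₂ (ascents x) (totalAscents r)) (sym (totalAscents-↭ (picks-↭ xr∈))))) ,
        trans (PermP.↭-length z↭) (sym (PermP.↭-length (picks-↭ xr∈)))
        where
        arith₁ : ∀ u v → suc (u + 0) + v ≡ suc (u + v)
        arith₁ = solve-∀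
        arith₂ : ∀ u v → (u + 0) + v ≡ u + v
        arith₂ = solve-∀

      statistics-join : {z : List Block} → z ∈ joinAtZero sP → Statistics z (suc d) (suc a) (length sP ∸ 1)
      statistics-join z∈ with ∈-concatMap-elim _ (picks sP) z∈
      ... | (y , r) , yr∈ , z∈′ with modifyEach-↭ (_++ Fin.zero ∷ y) z∈′
      ... | x , r′ , xr′∈ , z↭ with picked yr∈ (Relabelled.proper rel)
      ... | y-proper ∷ r-proper with picked xr′∈ r-proper
      ... | x-proper ∷ _ =
        trans (totalDescents-↭ z↭)
          (trans (cong (_+ totalDescents r′) (descents-join x y x-proper))
            (trans (arith (descents x) (descents y) (totalDescents r′))
              (cong suc (trans (cong (descents y +_) (sym (totalDescents-↭ (picks-↭ xr′∈))))
                               (sym (totalDescents-↭ (picks-↭ yr∈))))))) ,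
        trans (totalAscents-↭ z↭)
          (trans (cong (_+ totalAscents r′)
                   (trans (ascents-join x y x-proper) (cong (ascents x +_) (ascents-zero∷ y y-proper))))
            (trans (arith′ (ascents x) (ascents y) (totalAscents r′))
              (cong suc (trans (cong (ascents y +_) (sym (totalAscents-↭ (picks-↭ xr′∈))))
                               (sym (totalAscents-↭ (picks-↭ yr∈))))))) ,
        trans (PermP.↭-length z↭)
          (cong (_∸ 1) (trans (cong suc (sym (picks-rest-length xr′∈))) (sym (picks-rest-length yr∈))))
        where
        arith : ∀ u v w → suc (u + v) + w ≡ suc (v + (u + w))
        arith = solve-∀
        arith′ : ∀ u v w → (u + suc v) + w ≡ suc (v + (u + w))
        arith′ = solve-∀

module ListRecurrence {c ℓ : Level} (R : CommutativeSemiring c ℓ) where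

  open CommutativeSemiring R
  open import Data.Nat as ℕ using (zero; suc; _∸_)
  open import Data.Fin as Fin using (Fin)
  open import Data.List using (List; _∷_; [_]; _++_; length; concatMap)
  import Data.List.Properties as ListP
  open import Data.List.Membership.Propositional using (_∈_)
  open import Data.Product using (_×_; _,_)
  open import Relation.Binary.PropositionalEquality as ≡ using (_≡_)
  open import Relation.Binary.Reasoning.Setoid setoid
  open import Algebra.Properties.CommutativeSemigroup *-commutativeSemigroup using (x∙yz≈y∙xz; interchange)
  open Sums R
  open Recurrence R
  open ListFacts using (∈-concatMap-intro)
  open Arrangements using (picks; picks-length; picks-rest-length)
  open ListPartitions
  open InsertionStatistics

  module _ (x₁ x₂ : Carrier) where

    weight : {m : ℕ} → List (List (Fin m)) → Carrier
    weight z = pow R x₁ (totalDescents z) * pow R x₂ (totalAscents z)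

    listSum : ℕ → (ℕ → Carrier) → Carrier
    listSum n h = ∑ (λ z → weight z * h (length z)) (listPartitions n)

    -- the empty partition is the only list partition of Fin 0
    listSum-zero : (h : ℕ → Carrier) → listSum 0 h ≈ h 0
    listSum-zero h = trans (+-identityʳ _) (trans (*-congʳ (*-identityˡ _)) (*-identityˡ _))

    module _ {n : ℕ} {sP : List (List (Fin (suc n)))} (rel : Relabelled sP) (h : ℕ → Carrier) where

      private
        F : List (List (Fin (suc n))) → Carrier
        F z = weight z * h (length z)
        t = length sP
        d = totalDescents sP
        a = totalAscents sP
        w = weight sP

        F-statistics : ∀ z {d′ a′ t′} → Statistics z d′ a′ t′ → F z ≡ (pow R x₁ d′ * pow R x₂ a′) * h t′
        F-statistics z (des≡ , asc≡ , len≡) rewrite des≡ | asc≡ | len≡ = ≡.refl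

      -- every term of a kind has the same value; the sum is a multiple
      ∑-prependZero : ∑ F (prependZero sP) ≈ t ×ₙ (x₂ * (w * h t))
      ∑-prependZero = trans (∑-const F (prependZero sP) term)
        (reflexive (≡.cong (_×ₙ (x₂ * (w * h t))) (≡.trans (ListP.length-map _ (picks sP)) (picks-length sP))))
        where
        term : ∀ {z} → z ∈ prependZero sP → F z ≈ x₂ * (w * h t)
        term {z} z∈ = begin
          F z ≡⟨ F-statistics z (statistics-prepend rel z∈) ⟩
          (pow R x₁ d * (x₂ * pow R x₂ a)) * h t ≈⟨ *-congʳ (x∙yz≈y∙xz _ _ _) ⟩
          (x₂ * w) * h t                         ≈⟨ *-assoc _ _ _ ⟩
          x₂ * (w * h t)                         ∎

      ∑-appendZero : ∑ F (appendZero sP) ≈ t ×ₙ (x₁ * (w * h t))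
      ∑-appendZero = trans (∑-const F (appendZero sP) term)
        (reflexive (≡.cong (_×ₙ (x₁ * (w * h t))) (modifyEach-length _ sP)))
        where
        term : ∀ {z} → z ∈ appendZero sP → F z ≈ x₁ * (w * h t)
        term {z} z∈ = begin
          F z ≡⟨ F-statistics z (statistics-append rel z∈) ⟩
          ((x₁ * pow R x₁ d) * pow R x₂ a) * h t ≈⟨ *-congʳ (*-assoc _ _ _) ⟩
          (x₁ * w) * h t                         ≈⟨ *-assoc _ _ _ ⟩
          x₁ * (w * h t)                         ∎

      -- choose the block after 0 (t ways), then the block before it (t - 1 ways)
      ∑-joinAtZero : ∑ F (joinAtZero sP) ≈ (t ℕ.* (t ∸ 1)) ×ₙ ((x₁ * x₂) * (w * h (t ∸ 1)))
      ∑-joinAtZero = begin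
        ∑ F (joinAtZero sP)                     ≈⟨ ∑-concatMap F joins (picks sP) ⟩
        ∑ (λ p → ∑ F (joins p)) (picks sP)      ≈⟨ ∑-const _ (picks sP) perPick ⟩
        length (picks sP) ×ₙ ((t ∸ 1) ×ₙ J)     ≡⟨ ≡.cong (_×ₙ ((t ∸ 1) ×ₙ J)) (picks-length sP) ⟩
        t ×ₙ ((t ∸ 1) ×ₙ J)                     ≈⟨ ×-assocˡ J t (t ∸ 1) ⟩
        (t ℕ.* (t ∸ 1)) ×ₙ J                    ∎
        where
        J = (x₁ * x₂) * (w * h (t ∸ 1))
        joins : List (Fin (suc n)) × List (List (Fin (suc n))) → List (List (List (Fin (suc n))))
        joins (y , r) = modifyEach (_++ Fin.zero ∷ y) r
        term : ∀ {z} → z ∈ joinAtZero sP → F z ≈ J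
        term {z} z∈ = begin
          F z ≡⟨ F-statistics z (statistics-join rel z∈) ⟩
          ((x₁ * pow R x₁ d) * (x₂ * pow R x₂ a)) * h (t ∸ 1) ≈⟨ *-congʳ (interchange _ _ _ _) ⟩
          ((x₁ * x₂) * w) * h (t ∸ 1)                         ≈⟨ *-assoc _ _ _ ⟩
          J                                                   ∎
        perPick : ∀ {p} → p ∈ picks sP → ∑ F (joins p) ≈ (t ∸ 1) ×ₙ J
        perPick {y , r} yr∈ =
          trans (∑-const F (joins (y , r)) (λ z∈ → term (∈-concatMap-intro joins yr∈ z∈)))
            (reflexive (≡.cong (_×ₙ J) (≡.trans (modifyEach-length _ r)
                                         (≡.cong (_∸ 1) (≡.sym (picks-rest-length yr∈))))))

      ∑-insertZero : ∑ F (insertZero sP) ≈ w * D (eSeq R x₁ x₂) h t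
      ∑-insertZero = begin
        F ([ Fin.zero ] ∷ sP) + ∑ F (prependZero sP ++ (appendZero sP ++ joinAtZero sP))
          ≈⟨ +-congˡ (trans (∑-++ F (prependZero sP) _) (+-congˡ (∑-++ F (appendZero sP) _))) ⟩
        w * h (suc t) + (∑ F (prependZero sP) + (∑ F (appendZero sP) + ∑ F (joinAtZero sP)))
          ≈⟨ +-congˡ (+-cong ∑-prependZero (+-cong ∑-appendZero ∑-joinAtZero)) ⟩
        w * h (suc t) + (t ×ₙ (x₂ * X) + (t ×ₙ (x₁ * X) + k ×ₙ ((x₁ * x₂) * Y)))
          ≈⟨ +-congˡ (sym (+-assoc _ _ _)) ⟩
        w * h (suc t) + ((t ×ₙ (x₂ * X) + t ×ₙ (x₁ * X)) + k ×ₙ ((x₁ * x₂) * Y))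
          ≈⟨ sym (+-cong (*-congˡ (*-identityˡ _)) (+-cong middle last)) ⟩
        w * (1# * h (suc t)) + (w * (t ×ₙ ((x₁ + x₂) * h t)) + w * (k ×ₙ ((x₁ * x₂) * h (t ∸ 1))))
          ≈⟨ sym (trans (distribˡ w _ _) (+-congˡ (distribˡ w _ _))) ⟩
        w * D (eSeq R x₁ x₂) h t ∎
        where
        X = w * h t
        Y = w * h (t ∸ 1)
        k = t ℕ.* (t ∸ 1)
        middle : w * (t ×ₙ ((x₁ + x₂) * h t)) ≈ t ×ₙ (x₂ * X) + t ×ₙ (x₁ * X)
        middle = begin
          w * (t ×ₙ ((x₁ + x₂) * h t))  ≈⟨ ×-comm-* t w _ ⟩
          t ×ₙ (w * ((x₁ + x₂) * h t))  ≈⟨ ×-congʳ t (x∙yz≈y∙xz w (x₁ + x₂) (h t)) ⟩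
          t ×ₙ ((x₁ + x₂) * X)          ≈⟨ ×-congʳ t (trans (distribʳ X x₁ x₂) (+-comm _ _)) ⟩
          t ×ₙ (x₂ * X + x₁ * X)        ≈⟨ ×-distrib-+ _ _ t ⟩
          t ×ₙ (x₂ * X) + t ×ₙ (x₁ * X) ∎
        last : w * (k ×ₙ ((x₁ * x₂) * h (t ∸ 1))) ≈ k ×ₙ ((x₁ * x₂) * Y)
        last = trans (×-comm-* k w _) (×-congʳ k (x∙yz≈y∙xz w (x₁ * x₂) (h (t ∸ 1))))

    -- the recurrence step: group the partitions of Fin (n+1) by deleting 0
    listSum-suc : (n : ℕ) (h : ℕ → Carrier) → listSum (suc n) h ≈ listSum n (D (eSeq R x₁ x₂) h)
    listSum-suc n h = begin
      listSum (suc n) h                                   ≈⟨ ∑-↭ F listPartitions-decomposition ⟩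
      ∑ F (concatMap insertions (listPartitions n))       ≈⟨ ∑-concatMap F insertions (listPartitions n) ⟩
      ∑ (λ P → ∑ F (insertions P)) (listPartitions n)     ≈⟨ ∑-cong (listPartitions n) perPartition ⟩
      listSum n (D (eSeq R x₁ x₂) h)                      ∎
      where
      F : List (List (Fin (suc n))) → Carrier
      F z = weight z * h (length z)
      insertions : List (List (Fin n)) → List (List (List (Fin (suc n))))
      insertions P = insertZero (relabelBlocks P)
      relabel-invariant : (P : List (List (Fin n))) (g : ℕ → Carrier) →
                          weight (relabelBlocks P) * g (length (relabelBlocks P)) ≡ weight P * g (length P)
      relabel-invariant P g
        rewrite totalDescents-relabel P | totalAscents-relabel P | ListP.length-map Forests.relabel P = ≡.refl
      perPartition : ∀ {P} → P ∈ listPartitions n →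
                     ∑ F (insertions P) ≈ weight P * D (eSeq R x₁ x₂) h (length P)
      perPartition {P} P∈ = trans (∑-insertZero (relabelled (listPartitions-sound P∈)) h)
                                  (reflexive (relabel-invariant P (D (eSeq R x₁ x₂) h)))

    listSum-iterateD : (n : ℕ) (h : ℕ → Carrier) → listSum n h ≈ iterateD (eSeq R x₁ x₂) n h
    listSum-iterateD = recurrence-solution (eSeq R x₁ x₂) listSum listSum-zero listSum-suc

    LahPolyDesAsc-listSum : (y : Carrier) (n : ℕ) → LahPolyDesAsc R x₁ x₂ y n ≈ listSum n (pow R y)
    LahPolyDesAsc-listSum y n = ∑-cong (listPartitions n) (λ _ → *-comm _ _)

  pow-1# : ∀ k → pow R 1# k ≈ 1#
  pow-1# zero = refl
  pow-1# (suc k) = trans (*-identityˡ _) (pow-1# k)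

  LahPolyDesAsc-unrefined : (y : Carrier) (n : ℕ) → LahPolyDesAsc R 1# 1# y n ≈ LahPoly R y n
  LahPolyDesAsc-unrefined y n = ∑-cong (listPartitions n) λ {z} _ →
    trans (*-congˡ (trans (*-cong (pow-1# (totalDescents z)) (pow-1# (totalAscents z))) (*-identityˡ 1#)))
          (*-identityʳ _)

proposition6p2 : ∀ {c ℓ : Level} (R : CommutativeSemiring c ℓ) →
    let open CommutativeSemiring R in
    (∀ (y : Carrier) (n : ℕ) →
       LahPolyGen R (eSeq R 1# 1#) y n ≈ LahPoly R y n)
    × (∀ (x₁ x₂ y : Carrier) (n : ℕ) →
       LahPolyGen R (eSeq R x₁ x₂) y n ≈ LahPolyDesAsc R x₁ x₂ y n)
proposition6p2 R = (λ y n → trans (refinedLah 1# 1# y n) (LahPolyDesAsc-unrefined y n)) , refinedLah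
  where
  open CommutativeSemiring R
  open import Data.Product using (_,_)
  open import Relation.Binary.Reasoning.Setoid setoid
  open Recurrence R using (iterateD)
  open ForestRecurrence R using (forestSum; LahPolyGen-forestSum; forestSum-iterateD)
  open ListRecurrence R using (listSum; listSum-iterateD; LahPolyDesAsc-listSum; LahPolyDesAsc-unrefined)

  refinedLah : ∀ (x₁ x₂ y : Carrier) (n : ℕ) → LahPolyGen R (eSeq R x₁ x₂) y n ≈ LahPolyDesAsc R x₁ x₂ y n
  refinedLah x₁ x₂ y n = begin
    LahPolyGen R e y n            ≈⟨ LahPolyGen-forestSum e y n ⟩
    forestSum e n (pow R y)       ≈⟨ forestSum-iterateD e (λ _ → refl) n (pow R y) ⟩
    iterateD e n (pow R y)        ≈⟨ sym (listSum-iterateD x₁ x₂ n (pow R y)) ⟩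
    listSum x₁ x₂ n (pow R y)     ≈⟨ sym (LahPolyDesAsc-listSum x₁ x₂ y n) ⟩
    LahPolyDesAsc R x₁ x₂ y n     ∎
    where e = eSeq R x₁ x₂
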